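{- Let $T$ be a tree rooted in a vertex $r$, $\tau$ a threshold function for $T$, $u$ a vertex of $T$ that is not a leaf with children $v_1,\ldots,v_k$, and $b$ a non-negative integer. Suppose that for every $i\in[k]$ and every non-negative integer $b_i\leq n(T_{v_i})-1$ there is a set $Y\subseteq V(T_{v_i})\setminus\{v_i\}$ with $|Y|=b_i$, ${\rm dyn}(T_{v_i}-Y,\tau)=y_0(v_i,b_i)$ and ${\rm dyn}(T_{v_i}-Y,\tau^{v_i})=y_1(v_i,b_i)$. Then for $j\in\{0,1\}$, $y_j(u,b)=z_j'(u,b)$, where $$z_j'(u,b)=\max\Big\{\delta_j(\vec b,\vec c)+\sum_{i\in[k]:c_i=1}y_\in(v_i,b_i)+\sum_{i\in[k]:c_i=0}y_1(v_i,b_i)\Big\},$$ the maximum taken over all $\vec b=(b_1,\ldots,b_k)\in\mathcal{P}_k(b)$ and $\vec c=(c_1,\ldots,c_k)\in\{0,1\}^k$ with $\vec b\geq\vec c$ componentwise, and $\delta_j(\vec b,\vec c)=0$ if $|\{i\in[k]:c_i=0\text{ and }y_0(v_i,b_i)=y_1(v_i,b_i)\}|\geq\tau(u)-j$ and $\delta_j(\vec b,\vec c)=1$ otherwise. Moreover, if $b\leq n(T_u)-1$, there is a set $Y\subseteq V(T_u)\setminus\{u\}$ with $|Y|=b$ such that ${\rm dyn}(T_u-Y,\tau)=y_0(u,b)$ and ${\rm dyn}(T_u-Y,\tau^u)=y_1(u,b)$.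
   Context: A threshold function for a graph $G$ is a function $\tau:U\to\mathbb{Z}\cup\{\infty\}$ whose domain $U$ contains $V(G)$. For $D\subseteq V(G)$, the hull $H_{(G,\tau)}(D)$ is the smallest $H\subseteq V(G)$ with $D\subseteq H$ and $u\in H$ for every vertex $u$ with $|H\cap N_G(u)|\geq\tau(u)$; $D$ is a dynamic monopoly if $H_{(G,\tau)}(D)=V(G)$; ${\rm dyn}(G,\tau)$ is the minimum order of a dynamic monopoly (0 for the empty graph). For a vertex $u$, $\tau^u$ equals $\tau$ except $\tau^u(u)=\tau(u)-1$. $T_u$ is the subtree of $T$ induced by $u$ and its descendants, $n(T_u)$ its order. Define $y_\in(u,b)=\max\{{\rm dyn}(T_u-Y,\tau):Y\subseteq V(T_u),|Y|=b,u\in Y\}$, $y_0(u,b)=\max\{{\rm dyn}(T_u-Y,\tau):Y\subseteq V(T_u),|Y|=b,u\notin Y\}$, $y_1(u,b)=\max\{{\rm dyn}(T_u-Y,\tau^u):Y\subseteq V(T_u),|Y|=b,u\notin Y\}$, with $\max\emptyset=-\infty$ and sums involving $-\infty$ equal to $-\infty$. $[k]=\{1,\ldots,k\}$, $\mathcal{P}_k(b)=\{(b_1,\ldots,b_k)\in\mathbb{N}_0^k:b_1+\cdots+b_k=b\}$. -}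

module Defs where

open import Data.Nat as ℕ using (ℕ; zero; suc; _⊓_; _⊔_; _≤ᵇ_; _≡ᵇ_)
open import Data.Integer as ℤ using (ℤ; +_)
open import Data.Fin as Fin using (Fin; zero; suc; toℕ)
open import Data.Bool using (Bool; true; false; _∧_; _∨_; not; if_then_else_)
open import Data.List as List using (List; []; _∷_; _++_; map; filter; length; foldr; concatMap; allFin; upTo; cartesianProduct)
open import Data.Vec as Vec using (Vec; []; _∷_; lookup)
open import Data.Product using (_×_; _,_)
open import Relation.Nullary using (yes; no; does)
open import Relation.Binary.PropositionalEquality using (refl)

-- Rooted trees (finite rose trees); vertices are positions.

data Tree : Set where
  node : (k : ℕ) → (Fin k → Tree) → Tree

data Pos : Tree → Set where
  here  : ∀ {t} → Pos t
  there : ∀ {k f} (i : Fin k) → Pos (f i) → Pos (node k f)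

allPos : (t : Tree) → List (Pos t)
allPos (node k f) = here ∷ concatMap (λ i → map (there i) (allPos (f i))) (allFin k)

size : Tree → ℕ
size t = length (allPos t)

deg : Tree → ℕ
deg (node k f) = k

child : (t : Tree) → Fin (deg t) → Tree
child (node k f) i = f i

down : (t : Tree) (i : Fin (deg t)) → Pos (child t i) → Pos t
down (node k f) i p = there i p

sub : (t : Tree) → Pos t → Tree
sub t here = t
sub (node k f) (there i p) = sub (f i) p

emb : (t : Tree) (p : Pos t) → Pos (sub t p) → Pos t
emb t here q = q
emb (node k f) (there i p) q = there i (emb (f i) p q)

allB : ∀ {A : Set} → (A → Bool) → List A → Bool
allB p xs = foldr (λ x r → p x ∧ r) true xs

anyB : ∀ {A : Set} → (A → Bool) → List A → Bool
anyB p xs = foldr (λ x r → p x ∨ r) false xs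

filterB : ∀ {A : Set} → (A → Bool) → List A → List A
filterB p [] = []
filterB p (x ∷ xs) = if p x then x ∷ filterB p xs else filterB p xs

eqPos : ∀ {t} → Pos t → Pos t → Bool
eqPos here here = true
eqPos here (there _ _) = false
eqPos (there _ _) here = false
eqPos (there i p) (there j q) with i Fin.≟ j
... | yes refl = eqPos p q
... | no _ = false

isRoot : ∀ {t} → Pos t → Bool
isRoot here = true
isRoot (there _ _) = false

-- isChild p q : q is a child of p
isChild : ∀ {t} → Pos t → Pos t → Bool
isChild here here = false
isChild here (there i p) = isRoot p
isChild (there i p) here = false
isChild (there i p) (there j q) with i Fin.≟ j
... | yes refl = isChild p q
... | no _ = false

adj : ∀ {t} → Pos t → Pos t → Bool
adj x y = isChild x y ∨ isChild y x

data Thr : Set where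
  fin : ℤ → Thr
  ∞   : Thr

_-ᵗ_ : Thr → ℕ → Thr
fin z -ᵗ j = fin (z ℤ.- (+ j))
∞ -ᵗ j = ∞

reached : ℕ → Thr → Bool
reached m (fin z) = does (z ℤ.≤? (+ m))
reached m ∞ = false

-- τ^u for u the root:  τ^u(root) = τ(root) - 1
decRoot : ∀ {t} → (Pos t → Thr) → Pos t → Thr
decRoot τ here = τ here -ᵗ 1
decRoot τ (there i p) = τ (there i p)

sublists : ∀ {A : Set} → List A → List (List A)
sublists [] = [] ∷ []
sublists (x ∷ xs) = sublists xs ++ map (x ∷_) (sublists xs)

mem : ∀ {t} → List (Pos t) → Pos t → Bool
mem Y x = anyB (eqPos x) Y

card : ∀ {t} → (Pos t → Bool) → ℕ
card {t} S = length (filterB (λ x → S x) (allPos t))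

-- Hulls and dynamic monopolies in the induced subgraph T[S]
-- (S = set of present vertices; T - Y is T[S] with S the complement of Y)

-- |H ∩ N_{T[S]}(x)|  for H ⊆ S
nbrCount : ∀ {t} → (Pos t → Bool) → Pos t → ℕ
nbrCount {t} H x = length (filterB (λ y → H y ∧ adj x y) (allPos t))

closed : ∀ {t} → (S : Pos t → Bool) → (Pos t → Thr) → (D H : Pos t → Bool) → Bool
closed {t} S τ D H =
  allB (λ x → not (S x ∧ D x) ∨ H x) (allPos t) ∧
  allB (λ x → not (S x ∧ reached (nbrCount H x) (τ x)) ∨ H x) (allPos t)

subsetsOf : ∀ {t} → (Pos t → Bool) → List (List (Pos t))
subsetsOf {t} S = sublists (filterB (λ x → S x) (allPos t))

hull : ∀ {t} → (S : Pos t → Bool) → (Pos t → Thr) → (D : Pos t → Bool) → Pos t → Bool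
hull S τ D x = S x ∧ allB (λ H → not (closed S τ D (mem H)) ∨ mem H x) (subsetsOf S)

isDynMono : ∀ {t} → (S : Pos t → Bool) → (Pos t → Thr) → (D : Pos t → Bool) → Bool
isDynMono {t} S τ D = allB (λ x → not (S x) ∨ hull S τ D x) (allPos t)

-- dyn(T[S], τ): minimum order of a dynamic monopoly D ⊆ S
-- (S itself is always a dynamic monopoly, so card S is a valid initial bound)
dyn : (t : Tree) → (Pos t → Thr) → (S : Pos t → Bool) → ℕ
dyn t τ S = foldr _⊓_ (card S) (map length (filterB (λ D → isDynMono S τ (mem D)) (subsetsOf S)))

data Val : Set where
  -∞  : Val
  val : ℕ → Val

_+V_ : Val → Val → Val
-∞ +V _ = -∞
val m +V -∞ = -∞
val m +V val n = val (m ℕ.+ n)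

_⊔V_ : Val → Val → Val
-∞ ⊔V v = v
val m ⊔V -∞ = val m
val m ⊔V val n = val (m ⊔ n)

eqV : Val → Val → Bool
eqV -∞ -∞ = true
eqV (val m) (val n) = m ≡ᵇ n
eqV _ _ = false

maxV : List Val → Val
maxV = foldr _⊔V_ -∞

-- y_∈, y_0, y_1 for the root u of the tree t (i.e. t = T_u)

compl : ∀ {t} → List (Pos t) → Pos t → Bool
compl Y x = not (mem Y x)

yIn : (t : Tree) → (Pos t → Thr) → ℕ → Val
yIn t τ b = maxV (map (λ Y → val (dyn t τ (compl Y)))
  (filterB (λ Y → (length Y ≡ᵇ b) ∧ mem Y here) (sublists (allPos t))))

y0 : (t : Tree) → (Pos t → Thr) → ℕ → Val
y0 t τ b = maxV (map (λ Y → val (dyn t τ (compl Y)))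
  (filterB (λ Y → (length Y ≡ᵇ b) ∧ not (mem Y here)) (sublists (allPos t))))

y1 : (t : Tree) → (Pos t → Thr) → ℕ → Val
y1 t τ b = maxV (map (λ Y → val (dyn t (decRoot τ) (compl Y)))
  (filterB (λ Y → (length Y ≡ᵇ b) ∧ not (mem Y here)) (sublists (allPos t))))

yj : Fin 2 → (t : Tree) → (Pos t → Thr) → ℕ → Val
yj zero = y0
yj (suc _) = y1

vecsUpTo : (k b : ℕ) → List (Vec ℕ k)
vecsUpTo zero b = [] ∷ []
vecsUpTo (suc k) b = concatMap (λ x → map (x ∷_) (vecsUpTo k b)) (upTo (suc b))

compositions : (k b : ℕ) → List (Vec ℕ k)
compositions k b = filterB (λ v → Vec.sum v ≡ᵇ b) (vecsUpTo k b)

-- {0,1}^k  (true = 1)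
bits : (k : ℕ) → List (Vec Bool k)
bits zero = [] ∷ []
bits (suc k) = concatMap (λ c → map (c ∷_) (bits k)) (false ∷ true ∷ [])

τchild : (t : Tree) → (Pos t → Thr) → (i : Fin (deg t)) → Pos (child t i) → Thr
τchild t τ i p = τ (down t i p)

module _ (t : Tree) (τ : Pos t → Thr) where

  dominates : Vec ℕ (deg t) → Vec Bool (deg t) → Bool
  dominates bv cv = allB (λ i → not (lookup cv i) ∨ (1 ≤ᵇ lookup bv i)) (allFin (deg t))

  δ : Fin 2 → Vec ℕ (deg t) → Vec Bool (deg t) → ℕ
  δ j bv cv =
    if reached (length (filterB (λ i → not (lookup cv i) ∧
                   eqV (y0 (child t i) (τchild t τ i) (lookup bv i))
                       (y1 (child t i) (τchild t τ i) (lookup bv i))) (allFin (deg t))))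
               (τ here -ᵗ toℕ j)
    then 0 else 1

  zterm : Fin 2 → Vec ℕ (deg t) → Vec Bool (deg t) → Val
  zterm j bv cv = val (δ j bv cv) +V
    foldr _+V_ (val 0) (map (λ i →
      if lookup cv i then yIn (child t i) (τchild t τ i) (lookup bv i)
                     else y1 (child t i) (τchild t τ i) (lookup bv i)) (allFin (deg t)))

  z′ : Fin 2 → ℕ → Val
  z′ j b = maxV (map (λ { (bv , cv) → zterm j bv cv })
    (filterB (λ { (bv , cv) → dominates bv cv })
      (cartesianProduct (compositions (deg t) b) (bits (deg t)))))

module Submission where

-- Delete a set Y ∌ u from T_u and let S be what remains.  A smallest dynamic monopoly of S
-- either contains u, or activates u through at least τ(u) children v_i that become active from
-- below, at cost dyn(T_{v_i} ∩ S, τ); every other child only needs u's help, i.e. threshold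
-- τ^{v_i}, and dyn(·, τ^{v}) ≤ dyn(·, τ).  Hence, calling a present child tight when the two
-- values agree,
--   dyn(S, τ) = Σᵢ dyn(T_{v_i} ∩ S, τ^{v_i}) + [fewer than τ(u) children are tight],
-- and likewise for τ^u with τ(u) - 1.  Maximising over Y then splits into independent maxima
-- over the parts Y_i: v_i ∈ Y_i contributes y_∈ (the two thresholds agree when v_i is absent)
-- and v_i ∉ Y_i contributes y_1, and the hypothesis provides a single Y_i attaining y_0 and y_1
-- at once, so that v_i is tight exactly when y_0(v_i,b_i) = y_1(v_i,b_i).  Finally the optimal
-- values for j = 0 and j = 1 differ by at most one, so an optimum for one j is an optimum for both.

open import Defs
open import Data.Nat using (ℕ; zero; suc; _+_; _∸_; _⊓_; _≡ᵇ_; _≤ᵇ_; _≤_; _<_; z≤n; s≤s)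
open import Data.Nat.Properties
open import Algebra.Properties.Monoid.Sum +-0-monoid using (sum; sum-cong-≗)
import Data.Integer as ℤ
import Data.Integer.Properties as ℤ
open import Data.Bool using (Bool; true; false; not; _∧_; _∨_; if_then_else_)
open import Data.Bool.Properties using (∧-conicalˡ; ∧-conicalʳ; ∧-zeroʳ; ∧-identityʳ; not-¬; not-injective; T-≡)
open import Data.Fin using (Fin; zero; suc; toℕ)
import Data.Fin.Properties as Fin
open import Data.List using (List; []; _∷_; _++_; map; length; foldr; concatMap; allFin; tabulate; cartesianProduct)
open import Data.List.Properties using (map-tabulate)
open import Data.List.Relation.Unary.Any as Any using (Any)
open import Data.List.Relation.Unary.All as All using (All)
import Data.List.Relation.Unary.All.Properties as All
open import Data.List.Relation.Unary.AllPairs as AllPairs using (AllPairs)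
import Data.List.Relation.Unary.AllPairs.Properties as AllPairs
open import Data.List.Relation.Unary.Unique.Propositional using (Unique)
import Data.List.Relation.Unary.Unique.Propositional.Properties as Unique
open import Data.List.Relation.Binary.Disjoint.Propositional using (Disjoint)
open import Data.List.Relation.Binary.Sublist.Propositional using (_⊆_; []; _∷_; _∷ʳ_; ⊆-trans)
open import Data.List.Relation.Binary.Sublist.Propositional.Properties using (Any-resp-⊆; length-mono-≤)
open import Data.List.Membership.Propositional using (_∈_; _∉_; lose)
open import Data.List.Membership.Propositional.Properties
open import Data.Vec as Vec using (Vec; []; _∷_; lookup)
import Data.Vec.Properties as Vec
open import Data.Product using (Σ; ∃; _×_; _,_; proj₁; proj₂)
open import Data.Sum using (_⊎_; inj₁; inj₂)
open import Data.Empty using (⊥-elim)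
open import Relation.Nullary using (yes; no; does)
open import Relation.Nullary.Decidable using (dec-true; does-⇔)
open import Relation.Binary.PropositionalEquality
open import Function using (_∘_; mk⇔; Equivalence)

bit : Bool → ℕ
bit true = 1
bit false = 0

not-∨-elim : ∀ {a b} → not a ∨ b ≡ true → a ≡ true → b ≡ true
not-∨-elim e refl = e

not-∨-intro : ∀ {a b} → (a ≡ true → b ≡ true) → not a ∨ b ≡ true
not-∨-intro {true} h = h refl
not-∨-intro {false} h = refl

bit-mono : ∀ {a b} → (a ≡ true → b ≡ true) → bit a ≤ bit b
bit-mono {false} h = z≤n
bit-mono {true} h rewrite h refl = ≤-refl

≡ᵇ≡true⇒≡ : ∀ {m n} → (m ≡ᵇ n) ≡ true → m ≡ n
≡ᵇ≡true⇒≡ {m} {n} e = ≡ᵇ⇒≡ m n (Equivalence.from T-≡ e)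

≡⇒≡ᵇ≡true : ∀ {m n} → m ≡ n → (m ≡ᵇ n) ≡ true
≡⇒≡ᵇ≡true {m} {n} e = Equivalence.to T-≡ (≡⇒≡ᵇ m n e)

module _ {A : Set} where

  allB⁻ : (p : A → Bool) {xs : List A} {x : A} → allB p xs ≡ true → x ∈ xs → p x ≡ true
  allB⁻ p {y ∷ _} e (Any.here refl) = ∧-conicalˡ (p y) _ e
  allB⁻ p {y ∷ _} e (Any.there m) = allB⁻ p (∧-conicalʳ (p y) _ e) m

  allB⁺ : (p : A → Bool) (xs : List A) → (∀ x → x ∈ xs → p x ≡ true) → allB p xs ≡ true
  allB⁺ p [] h = refl
  allB⁺ p (y ∷ ys) h = cong₂ _∧_ (h y (Any.here refl)) (allB⁺ p ys (λ x → h x ∘ Any.there))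

  allB-cong : (p q : A → Bool) (xs : List A) → (∀ x → x ∈ xs → p x ≡ q x) → allB p xs ≡ allB q xs
  allB-cong p q [] h = refl
  allB-cong p q (y ∷ ys) h = cong₂ _∧_ (h y (Any.here refl)) (allB-cong p q ys (λ x → h x ∘ Any.there))

  anyB⁺ : (p : A → Bool) {xs : List A} {x : A} → x ∈ xs → p x ≡ true → anyB p xs ≡ true
  anyB⁺ p (Any.here refl) e rewrite e = refl
  anyB⁺ p {y ∷ _} (Any.there m) e with p y
  ... | true = refl
  ... | false = anyB⁺ p m e

  anyB⁻ : (p : A → Bool) (xs : List A) → anyB p xs ≡ true → ∃ λ x → x ∈ xs × p x ≡ true
  anyB⁻ p (y ∷ ys) e with p y in py
  ... | true = y , Any.here refl , py
  ... | false = let x , m , px = anyB⁻ p ys e in x , Any.there m , px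

  filterB-cong : (p q : A → Bool) (xs : List A) → (∀ x → x ∈ xs → p x ≡ q x) → filterB p xs ≡ filterB q xs
  filterB-cong p q [] h = refl
  filterB-cong p q (y ∷ ys) h rewrite h y (Any.here refl) | filterB-cong p q ys (λ x → h x ∘ Any.there) = refl

  ∈-filterB⁻ : (p : A → Bool) (xs : List A) {x : A} → x ∈ filterB p xs → x ∈ xs × p x ≡ true
  ∈-filterB⁻ p (y ∷ ys) m with p y in py | m
  ... | true | Any.here refl = Any.here refl , py
  ... | true | Any.there m′ = let m″ , px = ∈-filterB⁻ p ys m′ in Any.there m″ , px
  ... | false | m′ = let m″ , px = ∈-filterB⁻ p ys m′ in Any.there m″ , px

  ∈-filterB⁺ : (p : A → Bool) (xs : List A) {x : A} → x ∈ xs → p x ≡ true → x ∈ filterB p xs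
  ∈-filterB⁺ p (y ∷ ys) (Any.here refl) e rewrite e = Any.here refl
  ∈-filterB⁺ p (y ∷ ys) (Any.there m) e with p y
  ... | true = Any.there (∈-filterB⁺ p ys m e)
  ... | false = ∈-filterB⁺ p ys m e

  filterB-⊆ : (p : A → Bool) (xs : List A) → filterB p xs ⊆ xs
  filterB-⊆ p [] = []
  filterB-⊆ p (y ∷ ys) with p y
  ... | true = refl ∷ filterB-⊆ p ys
  ... | false = y ∷ʳ filterB-⊆ p ys

  length-filterB-mono : (p q : A → Bool) (xs : List A) → (∀ x → x ∈ xs → p x ≡ true → q x ≡ true) →
    length (filterB p xs) ≤ length (filterB q xs)
  length-filterB-mono p q [] h = z≤n
  length-filterB-mono p q (y ∷ ys) h with p y in py | q y in qy
  ... | true | true = s≤s (length-filterB-mono p q ys (λ x → h x ∘ Any.there))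
  ... | true | false = ⊥-elim (not-¬ (h y (Any.here refl) py) qy)
  ... | false | true = m≤n⇒m≤1+n (length-filterB-mono p q ys (λ x → h x ∘ Any.there))
  ... | false | false = length-filterB-mono p q ys (λ x → h x ∘ Any.there)

  length-filterB-∷ : (p : A → Bool) (x : A) (xs : List A) →
    length (filterB p (x ∷ xs)) ≡ bit (p x) + length (filterB p xs)
  length-filterB-∷ p x xs with p x
  ... | true = refl
  ... | false = refl

  length-filterB-++ : (p : A → Bool) (xs ys : List A) →
    length (filterB p (xs ++ ys)) ≡ length (filterB p xs) + length (filterB p ys)
  length-filterB-++ p [] ys = refl
  length-filterB-++ p (x ∷ xs) ys with p x
  ... | true = cong suc (length-filterB-++ p xs ys)
  ... | false = length-filterB-++ p xs ys

  length-filterB-none : (p : A → Bool) (xs : List A) → (∀ x → x ∈ xs → p x ≡ false) → length (filterB p xs) ≡ 0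
  length-filterB-none p [] h = refl
  length-filterB-none p (y ∷ ys) h rewrite h y (Any.here refl) = length-filterB-none p ys (λ x → h x ∘ Any.there)

length-filterB-map : {A C : Set} (p : C → Bool) (g : A → C) (xs : List A) →
  length (filterB p (map g xs)) ≡ length (filterB (p ∘ g) xs)
length-filterB-map p g [] = refl
length-filterB-map p g (x ∷ xs) with p (g x)
... | true = cong suc (length-filterB-map p g xs)
... | false = length-filterB-map p g xs

sum-mono-≤ : ∀ {k} {g h : Fin k → ℕ} → (∀ i → g i ≤ h i) → sum g ≤ sum h
sum-mono-≤ {zero} le = z≤n
sum-mono-≤ {suc k} le = +-mono-≤ (le zero) (sum-mono-≤ (le ∘ suc))

sum-mono-< : ∀ {k} {g h : Fin k → ℕ} → (∀ i → g i ≤ h i) → (i₀ : Fin k) → g i₀ < h i₀ → sum g < sum h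
sum-mono-< {suc k} le zero lt = +-mono-<-≤ lt (sum-mono-≤ (le ∘ suc))
sum-mono-< {suc k} le (suc i₀) lt = +-mono-≤-< (le zero) (sum-mono-< (le ∘ suc) i₀ lt)

sum-zero : ∀ k → sum {k} (λ _ → 0) ≡ 0
sum-zero zero = refl
sum-zero (suc k) = sum-zero k

sum-single : ∀ {k} (h : Fin k → ℕ) (i₀ : Fin k) → (∀ j → j ≢ i₀ → h j ≡ 0) → sum h ≡ h i₀
sum-single {suc k} h zero h0 =
  trans (cong (h zero +_) (trans (sum-cong-≗ (λ i → h0 (suc i) λ ())) (sum-zero k))) (+-identityʳ _)
sum-single {suc k} h (suc i₀) h0 rewrite h0 zero (λ ()) =
  sum-single (h ∘ suc) i₀ (λ j j≢i₀ → h0 (suc j) (j≢i₀ ∘ Fin.suc-injective))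

term≤sum : ∀ {k} (h : Fin k → ℕ) (i : Fin k) → h i ≤ sum h
term≤sum {suc k} h zero = m≤m+n _ _
term≤sum {suc k} h (suc i) = ≤-trans (term≤sum (h ∘ suc) i) (m≤n+m _ _)

zero-or-one≤1 : ∀ r → (if r then 0 else 1) ≤ 1
zero-or-one≤1 true = z≤n
zero-or-one≤1 false = ≤-refl

sum-plus-surcharge-≤ : ∀ {k} {A G : Fin k → ℕ} (r₁ r₂ : Bool) → (∀ i → A i ≤ G i) →
  (r₂ ≡ true → r₁ ≡ false → ∃ λ i → A i < G i) →
  sum A + (if r₁ then 0 else 1) ≤ (if r₂ then 0 else 1) + sum G
sum-plus-surcharge-≤ true r₂ A≤G _ = ≤-trans (≤-reflexive (+-identityʳ _)) (≤-trans (sum-mono-≤ A≤G) (m≤n+m _ _))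
sum-plus-surcharge-≤ false false A≤G _ = ≤-trans (≤-reflexive (+-comm _ 1)) (s≤s (sum-mono-≤ A≤G))
sum-plus-surcharge-≤ false true A≤G slack =
  let i , lt = slack refl refl in ≤-trans (≤-reflexive (+-comm _ 1)) (sum-mono-< A≤G i lt)

sum-lookup : ∀ {k} (v : Vec ℕ k) → Vec.sum v ≡ sum (lookup v)
sum-lookup [] = refl
sum-lookup (x ∷ v) = cong (x +_) (sum-lookup v)

length-filterB-tabulate : {A : Set} (k : ℕ) (p : A → Bool) (g : Fin k → A) →
  length (filterB p (tabulate g)) ≡ sum (λ i → bit (p (g i)))
length-filterB-tabulate zero p g = refl
length-filterB-tabulate (suc k) p g =
  trans (length-filterB-∷ p (g zero) (tabulate (g ∘ suc))) (cong (bit (p (g zero)) +_) (length-filterB-tabulate k p (g ∘ suc)))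

length-filterB-concatMap : {A C : Set} (k : ℕ) (p : C → Bool) (h : A → List C) (g : Fin k → A) →
  length (filterB p (concatMap h (tabulate g))) ≡ sum (λ i → length (filterB p (h (g i))))
length-filterB-concatMap zero p h g = refl
length-filterB-concatMap (suc k) p h g =
  trans (length-filterB-++ p (h (g zero)) (concatMap h (tabulate (g ∘ suc))))
        (cong (length (filterB p (h (g zero))) +_) (length-filterB-concatMap k p h (g ∘ suc)))

count : (k : ℕ) → (Fin k → Bool) → ℕ
count k P = length (filterB P (allFin k))

count≡sum : ∀ k (P : Fin k → Bool) → count k P ≡ sum (λ i → bit (P i))
count≡sum k P = length-filterB-tabulate k P (λ i → i)

count-cong : ∀ k {P Q : Fin k → Bool} → (∀ i → P i ≡ Q i) → count k P ≡ count k Q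
count-cong k {P} {Q} e = cong length (filterB-cong P Q (allFin k) (λ i _ → e i))

count-mono : ∀ k {P Q : Fin k → Bool} → (∀ i → P i ≡ true → Q i ≡ true) → count k P ≤ count k Q
count-mono k {P} {Q} h = length-filterB-mono P Q (allFin k) (λ i _ → h i)

⊆-or-witness : ∀ {k} (P Q : Fin k → Bool) →
  (∀ i → P i ≡ true → Q i ≡ true) ⊎ ∃ λ i → P i ≡ true × Q i ≡ false
⊆-or-witness {zero} P Q = inj₁ (λ ())
⊆-or-witness {suc k} P Q with P zero in p | Q zero in q | ⊆-or-witness (P ∘ suc) (Q ∘ suc)
... | true | false | _ = inj₂ (zero , p , q)
... | _ | _ | inj₂ (i , w) = inj₂ (suc i , w)
... | true | true | inj₁ h = inj₁ λ { zero _ → q ; (suc i) → h i }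
... | false | _ | inj₁ h = inj₁ λ { zero e → ⊥-elim (not-¬ e p) ; (suc i) → h i }

one-of-two-maxima : ∀ {x₀ x₁ y₀ y₁ m₀ m₁} → x₀ ≡ m₀ → y₁ ≡ m₁ → x₁ ≤ m₁ → y₀ ≤ m₀ →
  x₀ ≤ suc x₁ → y₁ ≤ y₀ → x₁ ≡ m₁ ⊎ y₀ ≡ m₀
one-of-two-maxima {x₁ = x₁} {m₁ = m₁} refl refl x₁≤m₁ y₀≤m₀ x₀≤1+x₁ y₁≤y₀ with x₁ ≟ m₁
... | yes x₁≡m₁ = inj₁ x₁≡m₁
... | no x₁≢m₁ = inj₂ (≤-antisym y₀≤m₀ (≤-trans x₀≤1+x₁ (≤-trans (≤∧≢⇒< x₁≤m₁ x₁≢m₁) y₁≤y₀)))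

reached-mono : ∀ {m n} θ → m ≤ n → reached m θ ≡ true → reached n θ ≡ true
reached-mono (fin z) m≤n r = dec-true (z ℤ.≤? _) (ℤ.≤-trans (reached⇒≤ r) (ℤ.+≤+ m≤n))
  where
  reached⇒≤ : ∀ {m} → reached m (fin z) ≡ true → z ℤ.≤ ℤ.+ m
  reached⇒≤ {m} r with z ℤ.≤? ℤ.+ m
  ... | yes z≤m = z≤m

reached-suc : ∀ m θ → reached (suc m) θ ≡ reached m (θ -ᵗ 1)
reached-suc m ∞ = refl
reached-suc m (fin z) = does-⇔ (mk⇔ (ℤ.+-monoˡ-≤ (ℤ.- ℤ.+ 1)) from) (z ℤ.≤? ℤ.+ suc m) (z ℤ.- ℤ.+ 1 ℤ.≤? ℤ.+ m)
  where
  z-1+1≡z : z ℤ.- ℤ.+ 1 ℤ.+ ℤ.+ 1 ≡ z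
  z-1+1≡z = trans (ℤ.+-assoc z (ℤ.- ℤ.+ 1) (ℤ.+ 1)) (ℤ.+-identityʳ z)
  from : z ℤ.- ℤ.+ 1 ℤ.≤ ℤ.+ m → z ℤ.≤ ℤ.+ suc m
  from le = subst₂ ℤ._≤_ z-1+1≡z (cong ℤ.+_ (+-comm m 1)) (ℤ.+-monoˡ-≤ (ℤ.+ 1) le)

reached-minus-zero : ∀ m θ → reached m (θ -ᵗ 0) ≡ reached m θ
reached-minus-zero m ∞ = refl
reached-minus-zero m (fin z) = cong (λ w → does (w ℤ.≤? ℤ.+ m)) (ℤ.+-identityʳ z)

reached-minus-one : ∀ m θ → reached m θ ≡ true → reached m (θ -ᵗ 1) ≡ true
reached-minus-one m θ r = trans (sym (reached-suc m θ)) (reached-mono θ (n≤1+n m) r)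

eqPos-refl : ∀ {t} (x : Pos t) → eqPos x x ≡ true
eqPos-refl here = refl
eqPos-refl (there i p) with i Fin.≟ i
... | yes refl = eqPos-refl p
... | no i≢i = ⊥-elim (i≢i refl)

eqPos⇒≡ : ∀ {t} (x y : Pos t) → eqPos x y ≡ true → x ≡ y
eqPos⇒≡ here here e = refl
eqPos⇒≡ (there i p) (there j q) e with i Fin.≟ j
... | yes refl = cong (there i) (eqPos⇒≡ p q e)

∈⇒mem : ∀ {t} {L : List (Pos t)} {x} → x ∈ L → mem L x ≡ true
∈⇒mem {x = x} x∈L = anyB⁺ (eqPos x) x∈L (eqPos-refl x)

mem⇒∈ : ∀ {t} (L : List (Pos t)) x → mem L x ≡ true → x ∈ L
mem⇒∈ L x e with anyB⁻ (eqPos x) L e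
... | y , y∈L , x≈y rewrite eqPos⇒≡ x y x≈y = y∈L

module _ {k : ℕ} {f : Fin k → Tree} where

  branch : Fin k → List (Pos (node k f))
  branch i = map (there i) (allPos (f i))

  childPos : List (Pos (node k f))
  childPos = concatMap branch (allFin k)

  ∈-childPos⁺ : ∀ i {p} → p ∈ allPos (f i) → there i p ∈ childPos
  ∈-childPos⁺ i p∈ = ∈-concatMap⁺ branch (lose (∈-allFin i) (∈-map⁺ (there i) p∈))

  ∈-childPos⁻ : ∀ {x} → x ∈ childPos → ∃ λ i → ∃ λ p → x ≡ there i p
  ∈-childPos⁻ x∈ with Any.satisfied (∈-concatMap⁻ branch {xs = allFin k} x∈)
  ... | i , x∈i with ∈-map⁻ (there i) x∈i
  ... | p , _ , refl = i , p , refl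

  here∉childPos : here ∉ childPos
  here∉childPos m with ∈-childPos⁻ m
  ... | _ , _ , ()

∈-allPos : ∀ {t} (x : Pos t) → x ∈ allPos t
∈-allPos {node k f} here = Any.here refl
∈-allPos {node k f} (there i p) = Any.there (∈-childPos⁺ i (∈-allPos p))

allPos-unique : (t : Tree) → Unique (allPos t)
allPos-unique (node k f) =
  All.tabulate (λ m here≡ → here∉childPos (subst (_∈ childPos) (sym here≡) m)) AllPairs.∷
  Unique.concat⁺ (subst (All Unique) (sym (map-tabulate (λ i → i) branch)) (All.tabulate⁺ λ i → branch-unique i))
                 (subst (AllPairs Disjoint) (sym (map-tabulate (λ i → i) branch)) (AllPairs.tabulate⁺ branch-disjoint))
  where
  branch-unique : ∀ i → Unique (branch {f = f} i)
  branch-unique i = Unique.map⁺ (λ { refl → refl }) (allPos-unique (f i))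
  branch-disjoint : ∀ {i j} → i ≢ j → Disjoint (branch {f = f} i) (branch j)
  branch-disjoint i≢j (x∈i , x∈j) with ∈-map⁻ (there _) x∈i | ∈-map⁻ (there _) x∈j
  ... | _ , _ , refl | _ , _ , refl = i≢j refl

module _ {A : Set} where

  sublists⇒⊆ : (ys : List A) {L : List A} → L ∈ sublists ys → L ⊆ ys
  sublists⇒⊆ [] (Any.here refl) = []
  sublists⇒⊆ (y ∷ ys) m with ∈-++⁻ (sublists ys) m
  ... | inj₁ m′ = y ∷ʳ sublists⇒⊆ ys m′
  ... | inj₂ m′ with ∈-map⁻ (y ∷_) m′
  ... | L , m″ , refl = refl ∷ sublists⇒⊆ ys m″

  filterB∈sublists : (p : A → Bool) (ys : List A) → filterB p ys ∈ sublists ys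
  filterB∈sublists p [] = Any.here refl
  filterB∈sublists p (y ∷ ys) with p y
  ... | true = ∈-++⁺ʳ (sublists ys) (∈-map⁺ (y ∷_) (filterB∈sublists p ys))
  ... | false = ∈-++⁺ˡ (filterB∈sublists p ys)

  sublist-of-length : (ys : List A) (b : ℕ) → b ≤ length ys → ∃ λ L → L ∈ sublists ys × length L ≡ b
  sublist-of-length ys zero _ = [] , []∈sublists ys , refl
    where
    []∈sublists : (ys : List A) → [] ∈ sublists ys
    []∈sublists [] = Any.here refl
    []∈sublists (y ∷ ys) = ∈-++⁺ˡ ([]∈sublists ys)
  sublist-of-length (y ∷ ys) (suc b) (s≤s b≤) with sublist-of-length ys b b≤
  ... | L , m , refl = y ∷ L , ∈-++⁺ʳ (sublists ys) (∈-map⁺ (y ∷_) m) , refl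

filterB-mem-⊆ : ∀ {t} {L ys : List (Pos t)} → L ⊆ ys → Unique ys → filterB (mem L) ys ≡ L
filterB-mem-⊆ [] _ = refl
filterB-mem-⊆ {L = L} (y ∷ʳ L⊆ys) (y∉ys AllPairs.∷ ys-unique) with mem L y in y∈L
... | true = ⊥-elim (All.lookup y∉ys (Any-resp-⊆ L⊆ys (mem⇒∈ L y y∈L)) refl)
... | false = filterB-mem-⊆ L⊆ys ys-unique
filterB-mem-⊆ {L = y ∷ L} {y ∷ ys} (refl ∷ L⊆ys) (y∉ys AllPairs.∷ ys-unique) rewrite eqPos-refl y =
  cong (y ∷_) (trans (filterB-cong _ _ ys mem-∷) (filterB-mem-⊆ L⊆ys ys-unique))
  where
  mem-∷ : ∀ z → z ∈ ys → mem (y ∷ L) z ≡ mem L z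
  mem-∷ z z∈ys with eqPos z y in z≈y
  ... | true = ⊥-elim (All.lookup y∉ys z∈ys (sym (eqPos⇒≡ z y z≈y)))
  ... | false = refl

mem-filterB-allPos : ∀ {t} (P : Pos t → Bool) (x : Pos t) → mem (filterB P (allPos t)) x ≡ P x
mem-filterB-allPos {t} P x with P x in Px
... | true = ∈⇒mem (∈-filterB⁺ P _ (∈-allPos x) Px)
... | false with mem (filterB P (allPos t)) x in x∈
... | false = refl
... | true = ⊥-elim (not-¬ (proj₂ (∈-filterB⁻ P (allPos t) (mem⇒∈ _ x x∈))) Px)

card-mem : ∀ {t} {L : List (Pos t)} → L ∈ sublists (allPos t) → card (mem L) ≡ length L
card-mem {t} m = cong length (filterB-mem-⊆ (sublists⇒⊆ (allPos t) m) (allPos-unique t))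

card-cong : ∀ {t} {S S′ : Pos t → Bool} → (∀ x → S x ≡ S′ x) → card S ≡ card S′
card-cong {t} {S} {S′} eS = cong length (filterB-cong (λ x → S x) (λ x → S′ x) (allPos t) (λ x _ → eS x))

-- Hulls and dynamic monopolies

infix 4 _⊆ᵇ_
_⊆ᵇ_ : ∀ {t} → (Pos t → Bool) → (Pos t → Bool) → Set
P ⊆ᵇ Q = ∀ x → P x ≡ true → Q x ≡ true

LaxerOn : ∀ {t} → (Pos t → Bool) → (τ τ′ : Pos t → Thr) → Set
LaxerOn S τ τ′ = ∀ x m → S x ≡ true → reached m (τ x) ≡ true → reached m (τ′ x) ≡ true

record IsClosed {t} (S : Pos t → Bool) (τ : Pos t → Thr) (D H : Pos t → Bool) : Set where
  field
    seed : ∀ x → S x ≡ true → D x ≡ true → H x ≡ true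
    step : ∀ x → S x ≡ true → reached (nbrCount H x) (τ x) ≡ true → H x ≡ true

record IsDynMono {t} (S : Pos t → Bool) (τ : Pos t → Thr) (D : Pos t → Bool) : Set where
  constructor dynMono
  field covers : S ⊆ᵇ hull S τ D
open IsDynMono

module _ {t : Tree} where

  closed⇒IsClosed : ∀ {S τ D H} → closed {t} S τ D H ≡ true → IsClosed S τ D H
  closed⇒IsClosed {S} {τ} {D} {H} e = record
    { seed = λ x Sx Dx → not-∨-elim (allB⁻ seedB (∧-conicalˡ _ _ e) (∈-allPos x)) (cong₂ _∧_ Sx Dx)
    ; step = λ x Sx r → not-∨-elim (allB⁻ stepB (∧-conicalʳ _ _ e) (∈-allPos x)) (cong₂ _∧_ Sx r)
    }
    where
    seedB stepB : Pos t → Bool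
    seedB x = not (S x ∧ D x) ∨ H x
    stepB x = not (S x ∧ reached (nbrCount H x) (τ x)) ∨ H x

  IsClosed⇒closed : ∀ {S τ D H} → IsClosed {t} S τ D H → closed S τ D H ≡ true
  IsClosed⇒closed {S} {τ} {D} {H} c = cong₂ _∧_
    (allB⁺ _ (allPos t) λ x _ → not-∨-intro λ e → seed x (∧-conicalˡ _ _ e) (∧-conicalʳ _ _ e))
    (allB⁺ _ (allPos t) λ x _ → not-∨-intro λ e → step x (∧-conicalˡ _ _ e) (∧-conicalʳ _ _ e))
    where open IsClosed c

  nbrCount-mono : ∀ {H H′ : Pos t → Bool} → H ⊆ᵇ H′ → ∀ x → nbrCount H x ≤ nbrCount H′ x
  nbrCount-mono h x = length-filterB-mono _ _ (allPos t)
    (λ y _ e → cong₂ _∧_ (h y (∧-conicalˡ _ _ e)) (∧-conicalʳ _ _ e))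

  IsClosed-resp : ∀ {S τ D H H′} → (∀ x → H x ≡ H′ x) → IsClosed {t} S τ D H → IsClosed S τ D H′
  IsClosed-resp {τ = τ} {H = H} {H′} eH c = record
    { seed = λ x Sx Dx → trans (sym (eH x)) (seed x Sx Dx)
    ; step = λ x Sx r → trans (sym (eH x)) (step x Sx (reached-mono (τ x) (nbrCount-mono H′⊆H x) r))
    }
    where
    open IsClosed c
    H′⊆H : H′ ⊆ᵇ H
    H′⊆H x e = trans (eH x) e

  hull⊆ : ∀ S τ D → hull {t} S τ D ⊆ᵇ S
  hull⊆ S τ D x e = ∧-conicalˡ (S x) _ e

  filterB∈subsetsOf : (H S : Pos t → Bool) → H ⊆ᵇ S → filterB H (allPos t) ∈ subsetsOf S
  filterB∈subsetsOf H S H⊆S = subst (_∈ subsetsOf S) (filterB-filterB (allPos t)) (filterB∈sublists H (filterB S (allPos t)))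
    where
    filterB-filterB : (xs : List (Pos t)) → filterB H (filterB S xs) ≡ filterB H xs
    filterB-filterB [] = refl
    filterB-filterB (y ∷ ys) with S y in Sy | H y in Hy
    ... | true | true rewrite Hy = cong (y ∷_) (filterB-filterB ys)
    ... | true | false rewrite Hy = filterB-filterB ys
    ... | false | true = ⊥-elim (not-¬ (H⊆S y Hy) Sy)
    ... | false | false = filterB-filterB ys

  hull-least : ∀ {S τ D H} → IsClosed {t} S τ D H → H ⊆ᵇ S → hull S τ D ⊆ᵇ H
  hull-least {S} {τ} {D} {H} c H⊆S x e =
    trans (sym (mem-filterB-allPos H x))
      (not-∨-elim (allB⁻ _ (∧-conicalʳ (S x) _ e) (filterB∈subsetsOf H S H⊆S))
                  (IsClosed⇒closed (IsClosed-resp (λ y → sym (mem-filterB-allPos H y)) c)))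

  hull-closed : ∀ {S τ D} → IsClosed {t} S τ D (hull S τ D)
  hull-closed {S} {τ} {D} = record
    { seed = λ x Sx Dx → in-every-closed x Sx λ L _ c → IsClosed.seed c x Sx Dx
    ; step = λ x Sx r → in-every-closed x Sx λ L L⊆S c →
        IsClosed.step c x Sx (reached-mono (τ x) (nbrCount-mono (hull-in L⊆S c) x) r)
    }
    where
    in-every-closed : ∀ x → S x ≡ true →
      (∀ L → L ∈ subsetsOf S → IsClosed S τ D (mem L) → mem L x ≡ true) → hull S τ D x ≡ true
    in-every-closed x Sx h = cong₂ _∧_ Sx (allB⁺ _ (subsetsOf S) λ L L⊆S → not-∨-intro (h L L⊆S ∘ closed⇒IsClosed))
    hull-in : ∀ {L} → L ∈ subsetsOf S → IsClosed S τ D (mem L) → hull S τ D ⊆ᵇ mem L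
    hull-in {L} L⊆S c y e = not-∨-elim (allB⁻ _ (∧-conicalʳ (S y) _ e) L⊆S) (IsClosed⇒closed c)

  hull-mono-seed : ∀ {S τ D D′} → D ⊆ᵇ D′ → hull {t} S τ D ⊆ᵇ hull S τ D′
  hull-mono-seed {S} {τ} {D} {D′} D⊆D′ = hull-least closed′ (hull⊆ S τ D′)
    where
    open IsClosed (hull-closed {S} {τ} {D′})
    closed′ : IsClosed S τ D (hull S τ D′)
    closed′ = record { seed = λ x Sx Dx → seed x Sx (D⊆D′ x Dx) ; step = step }

  hull-mono-thr : ∀ {S τ τ′ D} → LaxerOn {t} S τ τ′ → hull S τ D ⊆ᵇ hull S τ′ D
  hull-mono-thr {S} {τ} {τ′} {D} weaker = hull-least closed′ (hull⊆ S τ′ D)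
    where
    open IsClosed (hull-closed {S} {τ′} {D})
    closed′ : IsClosed S τ D (hull S τ′ D)
    closed′ = record { seed = seed ; step = λ x Sx r → step x Sx (weaker x _ Sx r) }

  closed-cong : ∀ {S S′ τ D H} → (∀ x → S x ≡ S′ x) → closed {t} S τ D H ≡ closed S′ τ D H
  closed-cong eS = cong₂ _∧_
    (allB-cong _ _ (allPos t) λ x _ → cong (λ s → not (s ∧ _) ∨ _) (eS x))
    (allB-cong _ _ (allPos t) λ x _ → cong (λ s → not (s ∧ _) ∨ _) (eS x))

  subsetsOf-cong : ∀ {S S′ : Pos t → Bool} → (∀ x → S x ≡ S′ x) → subsetsOf S ≡ subsetsOf S′
  subsetsOf-cong {S} {S′} eS = cong sublists (filterB-cong (λ x → S x) (λ x → S′ x) (allPos t) (λ x _ → eS x))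

  hull-cong : ∀ {S S′ τ D} → (∀ x → S x ≡ S′ x) → ∀ x → hull {t} S τ D x ≡ hull S′ τ D x
  hull-cong {S} {S′} {τ} {D} eS x = cong₂ _∧_ (eS x) (begin
    allB (λ H → not (closed S τ D (mem H)) ∨ mem H x) (subsetsOf S)   ≡⟨ cong (allB _) (subsetsOf-cong eS) ⟩
    allB (λ H → not (closed S τ D (mem H)) ∨ mem H x) (subsetsOf S′)  ≡⟨ allB-cong _ _ (subsetsOf S′) (λ H _ →
                                                                           cong (λ c → not c ∨ mem H x) (closed-cong {τ = τ} {D} {mem H} eS)) ⟩
    allB (λ H → not (closed S′ τ D (mem H)) ∨ mem H x) (subsetsOf S′) ∎)
    where open ≡-Reasoning

  dyn-cong : ∀ {S S′ τ} → (∀ x → S x ≡ S′ x) → dyn t τ S ≡ dyn t τ S′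
  dyn-cong {S} {S′} {τ} eS = cong₂ (λ c Ls → foldr _⊓_ c (map length Ls)) (card-cong eS) (begin
    filterB (λ D → isDynMono S τ (mem D)) (subsetsOf S)   ≡⟨ cong (filterB _) (subsetsOf-cong eS) ⟩
    filterB (λ D → isDynMono S τ (mem D)) (subsetsOf S′)  ≡⟨ filterB-cong _ _ (subsetsOf S′) (λ D _ → allB-cong _ _ (allPos t) λ x _ →
                                                               cong₂ (λ s h → not s ∨ h) (eS x) (hull-cong {τ = τ} {mem D} eS x)) ⟩
    filterB (λ D → isDynMono S′ τ (mem D)) (subsetsOf S′) ∎)
    where open ≡-Reasoning

  isDynMono⇒IsDynMono : ∀ {S τ D} → isDynMono {t} S τ D ≡ true → IsDynMono S τ D
  isDynMono⇒IsDynMono {S} e = dynMono λ x Sx → not-∨-elim (allB⁻ _ e (∈-allPos x)) Sx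

  IsDynMono⇒isDynMono : ∀ {S τ D} → IsDynMono {t} S τ D → isDynMono S τ D ≡ true
  IsDynMono⇒isDynMono {S} m = allB⁺ _ (allPos t) λ x _ → not-∨-intro (covers m x)

  dyn≤card : ∀ {S τ D} → IsDynMono S τ D → D ⊆ᵇ S → dyn t τ S ≤ card D
  dyn≤card {S} {τ} {D} mono D⊆S = foldr-⊓-≤ (card S) _
    (∈-map⁺ length (∈-filterB⁺ _ (subsetsOf S) (filterB∈subsetsOf D S D⊆S)
      (IsDynMono⇒isDynMono {S} {τ} (dynMono λ x Sx →
        hull-mono-seed {S} {τ} (λ y → trans (mem-filterB-allPos D y)) x (covers mono x Sx)))))
    where
    foldr-⊓-≤ : ∀ c (xs : List ℕ) {x} → x ∈ xs → foldr _⊓_ c xs ≤ x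
    foldr-⊓-≤ c (y ∷ ys) (Any.here refl) = m⊓n≤m y _
    foldr-⊓-≤ c (y ∷ ys) (Any.there m) = ≤-trans (m⊓n≤n y _) (foldr-⊓-≤ c ys m)

  record MinDynMono (S : Pos t → Bool) (τ : Pos t → Thr) : Set where
    field
      set     : Pos t → Bool
      mono    : IsDynMono S τ set
      set⊆S   : set ⊆ᵇ S
      optimal : card set ≡ dyn t τ S

  minDynMono : ∀ S τ → MinDynMono S τ
  minDynMono S τ with foldr-selective ⊓-sel (card S) (map length (filterB (λ D → isDynMono S τ (mem D)) (subsetsOf S)))
  ... | inj₁ dyn≡card = record
    { set = S
    ; mono = dynMono (λ x Sx → IsClosed.seed (hull-closed {S} {τ} {S}) x Sx Sx)
    ; set⊆S = λ _ e → e
    ; optimal = sym dyn≡card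
    }
  ... | inj₂ dyn∈ with ∈-map⁻ length dyn∈
  ... | L , L∈ , dyn≡ with ∈-filterB⁻ _ (subsetsOf S) L∈
  ... | L⊆S , L-mono = record
    { set = mem L
    ; mono = isDynMono⇒IsDynMono {S} {τ} L-mono
    ; set⊆S = λ x e → proj₂ (∈-filterB⁻ S (allPos t) (Any-resp-⊆ L⊆S′ (mem⇒∈ L x e)))
    ; optimal = trans (cong length (filterB-mem-⊆ (⊆-trans L⊆S′ (filterB-⊆ S (allPos t))) (allPos-unique t))) (sym dyn≡)
    }
    where
    L⊆S′ : L ⊆ filterB S (allPos t)
    L⊆S′ = sublists⇒⊆ _ L⊆S

dyn-mono-thr : ∀ t {S τ τ′} → LaxerOn {t} S τ τ′ → dyn t τ′ S ≤ dyn t τ S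
dyn-mono-thr t {S} {τ} {τ′} weaker = subst (dyn t τ′ S ≤_) optimal
  (dyn≤card {t} {S} {τ′} (dynMono λ x Sx → hull-mono-thr {S = S} {τ = τ} {τ′} {set} weaker x (covers mono x Sx)) set⊆S)
  where open MinDynMono (minDynMono {t} S τ)

IsDynMono⇒⊆closed : ∀ {t S τ D H} → IsDynMono {t} S τ D → IsClosed S τ D H → H ⊆ᵇ S → S ⊆ᵇ H
IsDynMono⇒⊆closed mono c H⊆S x Sx = hull-least c H⊆S x (covers mono x Sx)

reached-decRoot : ∀ {t} (ρ : Pos t → Thr) (p : Pos t) m → reached m (decRoot ρ p) ≡ reached (bit (isRoot p) + m) (ρ p)
reached-decRoot {node _ _} ρ here m = sym (reached-suc m (ρ here))
reached-decRoot {node _ _} ρ (there i p) m = refl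

decRoot-weaker : ∀ {t} (ρ : Pos t → Thr) x m → reached m (ρ x) ≡ true → reached m (decRoot ρ x) ≡ true
decRoot-weaker {node _ _} ρ here m r = reached-minus-one m (ρ here) r
decRoot-weaker {node _ _} ρ (there i p) m r = r

dyn-decRoot-≤ : ∀ t (ρ : Pos t → Thr) S → dyn t (decRoot ρ) S ≤ dyn t ρ S
dyn-decRoot-≤ t ρ S = dyn-mono-thr t {S} {ρ} {decRoot ρ} (λ x m _ → decRoot-weaker ρ x m)

dyn-decRoot-absent : ∀ t (ρ : Pos t → Thr) S → S here ≡ false → dyn t (decRoot ρ) S ≡ dyn t ρ S
dyn-decRoot-absent t@(node _ _) ρ S S-here = ≤-antisym (dyn-decRoot-≤ t ρ S) (dyn-mono-thr t {S} {decRoot ρ} {ρ} same-off-root)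
  where
  same-off-root : LaxerOn S (decRoot ρ) ρ
  same-off-root here m Sx _ = ⊥-elim (not-¬ Sx S-here)
  same-off-root (there i p) m _ r = r

IsDynMono-raise-root : ∀ {t S} {ρ : Pos t → Thr} {D} → hull S ρ D here ≡ true →
  IsDynMono S (decRoot ρ) D → IsDynMono S ρ D
IsDynMono-raise-root {node _ _} {S} {ρ} {D} root∈ mono = dynMono λ x Sx → hull-least closed′ (hull⊆ S ρ D) x (covers mono x Sx)
  where
  open IsClosed (hull-closed {S = S} {ρ} {D})
  closed′ : IsClosed S (decRoot ρ) D (hull S ρ D)
  closed′ = record { seed = seed ; step = λ { here _ _ → root∈ ; (there i p) → step (there i p) } }

-- A tree seen from its root

module _ {k : ℕ} {f : Fin k → Tree} where

  infixl 9 _↓_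
  _↓_ : {A : Set} → (Pos (node k f) → A) → (i : Fin k) → Pos (f i) → A
  (P ↓ i) p = P (there i p)

  glue : Bool → ((i : Fin k) → Pos (f i) → Bool) → Pos (node k f) → Bool
  glue r Hs here = r
  glue r Hs (there i p) = Hs i p

  length-filterB-childPos : (P : Pos (node k f) → Bool) →
    length (filterB P childPos) ≡ sum (λ i → length (filterB (P ↓ i) (allPos (f i))))
  length-filterB-childPos P = trans (length-filterB-concatMap k P branch (λ i → i))
                                    (sum-cong-≗ (λ i → length-filterB-map P (there i) (allPos (f i))))

  card-node : (P : Pos (node k f) → Bool) → card P ≡ bit (P here) + sum (λ i → card (P ↓ i))
  card-node P = trans (length-filterB-∷ (λ x → P x) here childPos) (cong (bit (P here) +_) (length-filterB-childPos P))

  adj-there-≢ : ∀ {i j} (p : Pos (f i)) (q : Pos (f j)) → i ≢ j → adj (there {k} {f} i p) (there j q) ≡ false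
  adj-there-≢ {i} {j} p q i≢j = cong₂ _∨_ (isChild-≢ p q i≢j) (isChild-≢ q p (i≢j ∘ sym))
    where
    isChild-≢ : ∀ {i j} (p : Pos (f i)) (q : Pos (f j)) → i ≢ j → isChild (there {k} {f} i p) (there j q) ≡ false
    isChild-≢ {i} {j} p q i≢j with i Fin.≟ j
    ... | yes i≡j = ⊥-elim (i≢j i≡j)
    ... | no _ = refl

  adj-there : ∀ {i} (p q : Pos (f i)) → adj (there {k} {f} i p) (there i q) ≡ adj p q
  adj-there {i} p q = cong₂ _∨_ (isChild-there p q) (isChild-there q p)
    where
    isChild-there : (p q : Pos (f i)) → isChild (there {k} {f} i p) (there i q) ≡ isChild p q
    isChild-there p q with i Fin.≟ i
    ... | yes refl = refl
    ... | no i≢i = ⊥-elim (i≢i refl)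

  nbrCount-here : (H : Pos (node k f) → Bool) → nbrCount H here ≡ sum (λ i → bit (H (there i here)))
  nbrCount-here H = begin
    nbrCount H here                                                 ≡⟨ length-filterB-∷ (λ y → H y ∧ adj here y) here childPos ⟩
    bit (H here ∧ false) + length (filterB (λ y → H y ∧ adj here y) childPos)
                                                                    ≡⟨ cong (λ b → bit b + length (filterB (λ y → H y ∧ adj here y) childPos))
                                                                            (∧-zeroʳ (H here)) ⟩
    length (filterB (λ y → H y ∧ adj here y) childPos)              ≡⟨ length-filterB-childPos _ ⟩
    sum (λ i → length (filterB (λ q → H (there i q) ∧ (isRoot q ∨ false)) (allPos (f i))))
                                                                    ≡⟨ sum-cong-≗ (λ i → only-root (H ↓ i)) ⟩
    sum (λ i → bit (H (there i here)))                              ∎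
    where
    open ≡-Reasoning
    only-root : ∀ {s} (G : Pos s → Bool) → length (filterB (λ q → G q ∧ (isRoot q ∨ false)) (allPos s)) ≡ bit (G here)
    only-root {node _ _} G = trans (length-filterB-∷ (λ q → G q ∧ (isRoot q ∨ false)) here childPos)
      (trans (cong₂ _+_ (cong bit (∧-identityʳ (G here))) (length-filterB-none _ childPos not-root)) (+-identityʳ _))
      where
      not-root : ∀ x → x ∈ childPos → G x ∧ (isRoot x ∨ false) ≡ false
      not-root x x∈ with ∈-childPos⁻ x∈
      ... | _ , _ , refl = ∧-zeroʳ (G x)

  nbrCount-there : (H : Pos (node k f) → Bool) (i : Fin k) (p : Pos (f i)) →
    nbrCount H (there i p) ≡ bit (H here ∧ isRoot p) + nbrCount (H ↓ i) p
  nbrCount-there H i p = begin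
    nbrCount H (there i p)                       ≡⟨ length-filterB-∷ (λ y → H y ∧ adj (there i p) y) here childPos ⟩
    bit (H here ∧ isRoot p) + length (filterB (λ y → H y ∧ adj (there i p) y) childPos)
                                                 ≡⟨ cong (bit (H here ∧ isRoot p) +_) (length-filterB-childPos _) ⟩
    bit (H here ∧ isRoot p) + sum (λ j → length (filterB (λ q → H (there j q) ∧ adj (there i p) (there j q)) (allPos (f j))))
                                                 ≡⟨ cong (bit (H here ∧ isRoot p) +_) (sum-single _ i other-branch) ⟩
    bit (H here ∧ isRoot p) + length (filterB (λ q → H (there i q) ∧ adj (there i p) (there i q)) (allPos (f i)))
                                                 ≡⟨ cong (λ n → bit (H here ∧ isRoot p) + length n)
                                                       (filterB-cong _ _ (allPos (f i)) λ q _ → cong (H (there i q) ∧_) (adj-there p q)) ⟩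
    bit (H here ∧ isRoot p) + nbrCount (H ↓ i) p ∎
    where
    open ≡-Reasoning
    other-branch : ∀ j → j ≢ i → length (filterB (λ q → H (there j q) ∧ adj (there i p) (there j q)) (allPos (f j))) ≡ 0
    other-branch j j≢i = length-filterB-none _ (allPos (f j)) λ q _ →
      trans (cong (H (there j q) ∧_) (adj-there-≢ p q (j≢i ∘ sym))) (∧-zeroʳ _)

  module _ {S : Pos (node k f) → Bool} {ρ : Pos (node k f) → Thr} {D : Pos (node k f) → Bool} where

    IsClosed-↓ : ∀ {H} → IsClosed S ρ D H → ∀ i → IsClosed (S ↓ i) (ρ ↓ i) (D ↓ i) (H ↓ i)
    IsClosed-↓ {H} c i = record
      { seed = λ p → seed (there i p)
      ; step = λ p Sp r → step (there i p) Sp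
          (reached-mono (ρ (there i p)) (subst (nbrCount (H ↓ i) p ≤_) (sym (nbrCount-there H i p)) (m≤n+m _ _)) r)
      }
      where open IsClosed c

    IsClosed-↓-decRoot : ∀ {H} → H here ≡ true → IsClosed S ρ D H → ∀ i → IsClosed (S ↓ i) (decRoot (ρ ↓ i)) (D ↓ i) (H ↓ i)
    IsClosed-↓-decRoot {H} root∈ c i = record
      { seed = λ p → seed (there i p)
      ; step = λ p Sp r → step (there i p) Sp (subst (λ m → reached m (ρ (there i p)) ≡ true)
          (trans (cong (λ b → bit (b ∧ isRoot p) + nbrCount (H ↓ i) p) (sym root∈)) (sym (nbrCount-there H i p)))
          (trans (sym (reached-decRoot (ρ ↓ i) p _)) r))
      }
      where open IsClosed c

    IsClosed-glue-true : ∀ Hs → (∀ i → IsClosed (S ↓ i) (decRoot (ρ ↓ i)) (D ↓ i) (Hs i)) → IsClosed S ρ D (glue true Hs)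
    IsClosed-glue-true Hs cs = record { seed = seed′ ; step = step′ }
      where
      seed′ : ∀ x → S x ≡ true → D x ≡ true → glue true Hs x ≡ true
      seed′ here _ _ = refl
      seed′ (there i p) = IsClosed.seed (cs i) p
      step′ : ∀ x → S x ≡ true → reached (nbrCount (glue true Hs) x) (ρ x) ≡ true → glue true Hs x ≡ true
      step′ here _ _ = refl
      step′ (there i p) Sp r = IsClosed.step (cs i) p Sp (trans (reached-decRoot (ρ ↓ i) p (nbrCount (Hs i) p))
        (subst (λ m → reached m (ρ (there i p)) ≡ true) (nbrCount-there (glue true Hs) i p) r))

    IsClosed-glue-false : ∀ Hs → (S here ≡ true → D here ≡ false) → reached (sum (λ i → bit (Hs i here))) (ρ here) ≡ false →
      (∀ i → IsClosed (S ↓ i) (ρ ↓ i) (D ↓ i) (Hs i)) → IsClosed S ρ D (glue false Hs)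
    IsClosed-glue-false Hs root∉D below cs = record { seed = seed′ ; step = step′ }
      where
      seed′ : ∀ x → S x ≡ true → D x ≡ true → glue false Hs x ≡ true
      seed′ here Sx Dx = ⊥-elim (not-¬ Dx (root∉D Sx))
      seed′ (there i p) = IsClosed.seed (cs i) p
      step′ : ∀ x → S x ≡ true → reached (nbrCount (glue false Hs) x) (ρ x) ≡ true → glue false Hs x ≡ true
      step′ here _ r = ⊥-elim (not-¬ (subst (λ m → reached m (ρ here) ≡ true) (nbrCount-here (glue false Hs)) r) below)
      step′ (there i p) Sp r = IsClosed.step (cs i) p Sp
        (subst (λ m → reached m (ρ (there i p)) ≡ true) (nbrCount-there (glue false Hs) i p) r)

  module _ {S : Pos (node k f) → Bool} {ρ : Pos (node k f) → Thr} (root∈S : S here ≡ true) where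

    IsDynMono-glue-true : ∀ Ds → (∀ i → IsDynMono (S ↓ i) (decRoot (ρ ↓ i)) (Ds i)) → IsDynMono S ρ (glue true Ds)
    IsDynMono-glue-true Ds monos = dynMono λ where
        here _ → root∈H
        (there i p) → IsDynMono⇒⊆closed (monos i) (IsClosed-↓-decRoot root∈H H-closed i) (λ q → hull⊆ S ρ _ (there i q)) p
      where
      H-closed : IsClosed S ρ (glue true Ds) (hull S ρ (glue true Ds))
      H-closed = hull-closed
      root∈H : hull S ρ (glue true Ds) here ≡ true
      root∈H = IsClosed.seed H-closed here root∈S refl

    IsDynMono-glue-false : ∀ Ds (C : Fin k → Bool) → reached (count k C) (ρ here) ≡ true →
      (∀ i → C i ≡ true → S (there i here) ≡ true × IsDynMono (S ↓ i) (ρ ↓ i) (Ds i)) →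
      (∀ i → C i ≡ false → IsDynMono (S ↓ i) (decRoot (ρ ↓ i)) (Ds i)) →
      IsDynMono S ρ (glue false Ds)
    IsDynMono-glue-false Ds C enough on off = dynMono λ where
        here _ → root∈H
        (there i p) → child∈H i p
      where
      H = hull S ρ (glue false Ds)
      H-closed : IsClosed S ρ (glue false Ds) H
      H-closed = hull-closed
      H↓⊆S↓ : ∀ i → H ↓ i ⊆ᵇ S ↓ i
      H↓⊆S↓ i q = hull⊆ S ρ (glue false Ds) (there i q)
      on-full : ∀ i → C i ≡ true → S ↓ i ⊆ᵇ H ↓ i
      on-full i Ci = IsDynMono⇒⊆closed (proj₂ (on i Ci)) (IsClosed-↓ H-closed i) (H↓⊆S↓ i)
      root∈H : H here ≡ true
      root∈H = IsClosed.step H-closed here root∈S (subst (λ m → reached m (ρ here) ≡ true) (sym (nbrCount-here H))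
        (reached-mono (ρ here) (subst (_≤ sum (λ i → bit (H (there i here)))) (sym (count≡sum k C))
          (sum-mono-≤ λ i → bit-mono λ Ci → on-full i Ci here (proj₁ (on i Ci)))) enough))
      child∈H : ∀ i → S ↓ i ⊆ᵇ H ↓ i
      child∈H i with C i in Ci
      ... | true = on-full i Ci
      ... | false = IsDynMono⇒⊆closed (off i Ci) (IsClosed-↓-decRoot root∈H H-closed i) (H↓⊆S↓ i)

    module _ {D : Pos (node k f) → Bool} (mono : IsDynMono S ρ D) where

      IsDynMono-↓ : ∀ i → IsDynMono (S ↓ i) (decRoot (ρ ↓ i)) (D ↓ i)
      IsDynMono-↓ i = dynMono λ p Sp → hull-least H′-closed H′⊆S (there i p) (covers mono (there i p) Sp)
        where
        H′ = glue true (λ j → hull (S ↓ j) (decRoot (ρ ↓ j)) (D ↓ j))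
        H′-closed : IsClosed S ρ D H′
        H′-closed = IsClosed-glue-true _ (λ j → hull-closed)
        H′⊆S : H′ ⊆ᵇ S
        H′⊆S here _ = root∈S
        H′⊆S (there j q) = hull⊆ (S ↓ j) (decRoot (ρ ↓ j)) (D ↓ j) q

      root-activated : D here ≡ false → reached (sum (λ i → bit (hull (S ↓ i) (ρ ↓ i) (D ↓ i) here))) (ρ here) ≡ true
      root-activated root∉D with reached (sum (λ i → bit (hull (S ↓ i) (ρ ↓ i) (D ↓ i) here))) (ρ here) in below
      ... | true = refl
      ... | false = ⊥-elim (not-¬ (hull-least H′-closed H′⊆S here (covers mono here root∈S)) refl)
        where
        H′ = glue false (λ j → hull (S ↓ j) (ρ ↓ j) (D ↓ j))
        H′-closed : IsClosed S ρ D H′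
        H′-closed = IsClosed-glue-false _ (λ _ → root∉D) below (λ j → hull-closed)
        H′⊆S : H′ ⊆ᵇ S
        H′⊆S (there j q) = hull⊆ (S ↓ j) (ρ ↓ j) (D ↓ j) q

bit-here≤card : ∀ {t} (P : Pos t → Bool) → bit (P here) ≤ card P
bit-here≤card {node _ _} P = subst (bit (P here) ≤_) (sym (card-node P)) (m≤m+n _ _)

-- dyn of a tree whose root is present

module RootFormula {k} {f : Fin k → Tree} (ρ : Pos (node k f) → Thr) (S : Pos (node k f) → Bool) where

  a a′ : Fin k → ℕ
  a i = dyn (f i) (ρ ↓ i) (S ↓ i)
  a′ i = dyn (f i) (decRoot (ρ ↓ i)) (S ↓ i)

  tight : Fin k → Bool
  tight i = S (there i here) ∧ (a i ≡ᵇ a′ i)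

  surcharge : ℕ
  surcharge = if reached (count k tight) (ρ here) then 0 else 1

  module _ (root∈S : S here ≡ true) where

    private
      M M′ : (i : Fin k) → MinDynMono (S ↓ i) _
      M i = minDynMono (S ↓ i) (ρ ↓ i)
      M′ i = minDynMono (S ↓ i) (decRoot (ρ ↓ i))

    dyn≤sum-tight : reached (count k tight) (ρ here) ≡ true → dyn (node k f) ρ S ≤ sum a′
    dyn≤sum-tight enough = subst (dyn (node k f) ρ S ≤_) card-D (dyn≤card mono-D D⊆S)
      where
      Ds : (i : Fin k) → Pos (f i) → Bool
      Ds i = if tight i then MinDynMono.set (M i) else MinDynMono.set (M′ i)
      mono-D : IsDynMono S ρ (glue false Ds)
      mono-D = IsDynMono-glue-false root∈S Ds tight enough on off
        where
        on : ∀ i → tight i ≡ true → S (there i here) ≡ true × IsDynMono (S ↓ i) (ρ ↓ i) (Ds i)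
        on i Ti rewrite Ti = ∧-conicalˡ _ _ Ti , MinDynMono.mono (M i)
        off : ∀ i → tight i ≡ false → IsDynMono (S ↓ i) (decRoot (ρ ↓ i)) (Ds i)
        off i Ti rewrite Ti = MinDynMono.mono (M′ i)
      D⊆S : glue false Ds ⊆ᵇ S
      D⊆S (there i p) with tight i
      ... | true = MinDynMono.set⊆S (M i) p
      ... | false = MinDynMono.set⊆S (M′ i) p
      card-Ds : ∀ i → card (Ds i) ≡ a′ i
      card-Ds i with tight i in Ti
      ... | true = trans (MinDynMono.optimal (M i)) (≡ᵇ≡true⇒≡ (∧-conicalʳ _ _ Ti))
      ... | false = MinDynMono.optimal (M′ i)
      card-D : card (glue false Ds) ≡ sum a′
      card-D = trans (card-node (glue false Ds)) (sum-cong-≗ card-Ds)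

    dyn≤1+sum : dyn (node k f) ρ S ≤ sum a′ + 1
    dyn≤1+sum = subst (dyn (node k f) ρ S ≤_) card-D (dyn≤card mono-D D⊆S)
      where
      Ds : (i : Fin k) → Pos (f i) → Bool
      Ds i = MinDynMono.set (M′ i)
      mono-D : IsDynMono S ρ (glue true Ds)
      mono-D = IsDynMono-glue-true root∈S Ds (MinDynMono.mono ∘ M′)
      D⊆S : glue true Ds ⊆ᵇ S
      D⊆S here _ = root∈S
      D⊆S (there i p) = MinDynMono.set⊆S (M′ i) p
      card-D : card (glue true Ds) ≡ sum a′ + 1
      card-D = trans (card-node (glue true Ds)) (trans (cong suc (sum-cong-≗ (MinDynMono.optimal ∘ M′))) (+-comm 1 _))

    dyn≤ : dyn (node k f) ρ S ≤ sum a′ + surcharge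
    dyn≤ with reached (count k tight) (ρ here) in enough
    ... | true = subst (dyn (node k f) ρ S ≤_) (sym (+-identityʳ _)) (dyn≤sum-tight enough)
    ... | false = dyn≤1+sum

    module _ where
      open MinDynMono (minDynMono S ρ) renaming (set to D)

      private
        activated : Fin k → Bool
        activated i = hull (S ↓ i) (ρ ↓ i) (D ↓ i) here

      a′≤card : ∀ i → a′ i ≤ card (D ↓ i)
      a′≤card i = dyn≤card (IsDynMono-↓ {ρ = ρ} root∈S mono i) (λ p → set⊆S (there i p))

      a≤card : ∀ i → activated i ≡ true → a i ≤ card (D ↓ i)
      a≤card i act = dyn≤card (IsDynMono-raise-root {ρ = ρ ↓ i} act (IsDynMono-↓ {ρ = ρ} root∈S mono i)) (λ p → set⊆S (there i p))

      some-a′<card : D here ≡ false → reached (count k tight) (ρ here) ≡ false → ∃ λ i → a′ i < card (D ↓ i)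
      some-a′<card root∉D not-enough with ⊆-or-witness activated tight
      ... | inj₁ act⊆tight = ⊥-elim (not-¬ (reached-mono (ρ here) (count-mono k act⊆tight) enough-activated) not-enough)
        where
        enough-activated : reached (count k activated) (ρ here) ≡ true
        enough-activated = subst (λ m → reached m (ρ here) ≡ true) (sym (count≡sum k activated))
                                 (root-activated {ρ = ρ} root∈S mono root∉D)
      ... | inj₂ (i , act , not-tight) = i , <-≤-trans (≤∧≢⇒< (dyn-decRoot-≤ (f i) (ρ ↓ i) (S ↓ i)) a′≢a) (a≤card i act)
        where
        a′≢a : a′ i ≢ a i
        a′≢a a′≡a = not-¬ (cong₂ _∧_ (hull⊆ (S ↓ i) (ρ ↓ i) (D ↓ i) here act) (≡⇒≡ᵇ≡true (sym a′≡a))) not-tight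

      dyn≥ : sum a′ + surcharge ≤ dyn (node k f) ρ S
      dyn≥ = subst (sum a′ + surcharge ≤_) (trans (sym (card-node D)) optimal) (bound (D here) refl)
        where
        bound : ∀ r → D here ≡ r → sum a′ + surcharge ≤ bit r + sum (λ i → card (D ↓ i))
        bound true _ = subst (_≤ suc (sum (λ i → card (D ↓ i)))) (+-comm surcharge _)
                                (+-mono-≤ (zero-or-one≤1 _) (sum-mono-≤ a′≤card))
        bound false root∉D with reached (count k tight) (ρ here) in enough
        ... | true = subst (_≤ sum (λ i → card (D ↓ i))) (sym (+-identityʳ _)) (sum-mono-≤ a′≤card)
        ... | false = let i , lt = some-a′<card root∉D enough in
                      subst (_≤ sum (λ i → card (D ↓ i))) (+-comm 1 _) (sum-mono-< a′≤card i lt)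

    dyn-root-formula : dyn (node k f) ρ S ≡ sum a′ + surcharge
    dyn-root-formula = ≤-antisym dyn≤ dyn≥

infix 4 _≤V_
data _≤V_ : Val → Val → Set where
  -∞≤ : ∀ {v} → -∞ ≤V v
  val≤ : ∀ {m n} → m ≤ n → val m ≤V val n

val-injective : ∀ {m n} → val m ≡ val n → m ≡ n
val-injective refl = refl

≤V-antisym : ∀ {u v} → u ≤V v → v ≤V u → u ≡ v
≤V-antisym -∞≤ -∞≤ = refl
≤V-antisym (val≤ m≤n) (val≤ n≤m) = cong val (≤-antisym m≤n n≤m)

≤V-trans : ∀ {u v w} → u ≤V v → v ≤V w → u ≤V w
≤V-trans -∞≤ _ = -∞≤
≤V-trans (val≤ m≤n) (val≤ n≤o) = val≤ (≤-trans m≤n n≤o)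

val≤V⁻ : ∀ {m v} → val m ≤V v → ∃ λ n → v ≡ val n × m ≤ n
val≤V⁻ (val≤ m≤n) = _ , refl , m≤n

⊔V-sel : ∀ u v → (u ⊔V v ≡ u) ⊎ (u ⊔V v ≡ v)
⊔V-sel -∞ v = inj₂ refl
⊔V-sel (val m) -∞ = inj₁ refl
⊔V-sel (val m) (val n) with ⊔-sel m n
... | inj₁ e = inj₁ (cong val e)
... | inj₂ e = inj₂ (cong val e)

maxV-upper : ∀ (xs : List Val) {v} → v ∈ xs → v ≤V maxV xs
maxV-upper (x ∷ xs) (Any.here refl) = upperˡ x (maxV xs)
  where
  upperˡ : ∀ u v → u ≤V u ⊔V v
  upperˡ -∞ v = -∞≤
  upperˡ (val m) -∞ = val≤ ≤-refl
  upperˡ (val m) (val n) = val≤ (m≤m⊔n m n)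
maxV-upper (x ∷ xs) (Any.there v∈) = ≤V-trans (maxV-upper xs v∈) (upperʳ x (maxV xs))
  where
  upperʳ : ∀ u v → v ≤V u ⊔V v
  upperʳ -∞ v = ≤V-refl v
    where
    ≤V-refl : ∀ v → v ≤V v
    ≤V-refl -∞ = -∞≤
    ≤V-refl (val n) = val≤ ≤-refl
  upperʳ (val m) -∞ = -∞≤
  upperʳ (val m) (val n) = val≤ (m≤n⊔m m n)

maxV-least : ∀ (xs : List Val) {w} → (∀ v → v ∈ xs → v ≤V w) → maxV xs ≤V w
maxV-least [] h = -∞≤
maxV-least (x ∷ xs) h = lub (h x (Any.here refl)) (maxV-least xs (λ v → h v ∘ Any.there))
  where
  lub : ∀ {u v w} → u ≤V w → v ≤V w → u ⊔V v ≤V w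
  lub -∞≤ v≤w = v≤w
  lub (val≤ m≤o) -∞≤ = val≤ m≤o
  lub (val≤ m≤o) (val≤ n≤o) = val≤ (⊔-lub m≤o n≤o)

maxV-attained : ∀ (xs : List Val) {n} → maxV xs ≡ val n → val n ∈ xs
maxV-attained xs {n} e with foldr-selective ⊔V-sel -∞ xs
... | inj₁ max≡-∞ with () ← trans (sym e) max≡-∞
... | inj₂ max∈ = subst (_∈ xs) e max∈

sumV : ∀ {k} → (Fin k → Val) → Val
sumV G = foldr _+V_ (val 0) (map G (allFin _))

sumV-val : ∀ {k} (G : Fin k → Val) (g : Fin k → ℕ) → (∀ i → G i ≡ val (g i)) → sumV G ≡ val (sum g)
sumV-val G g G≡g = go _ (λ i → i) G≡g
  where
  go : ∀ {A : Set} k {G′ : A → Val} (h : Fin k → A) {g′ : Fin k → ℕ} → (∀ i → G′ (h i) ≡ val (g′ i)) →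
    foldr _+V_ (val 0) (map G′ (tabulate h)) ≡ val (sum g′)
  go zero h eq = refl
  go (suc k) {G′} h {g′} eq rewrite eq zero | go k {G′} (h ∘ suc) {g′ ∘ suc} (eq ∘ suc) = refl

sumV-val⁻ : ∀ {k} (G : Fin k → Val) {s} → sumV G ≡ val s → ∃ λ g → (∀ i → G i ≡ val (g i)) × s ≡ sum g
sumV-val⁻ G G≡s = go _ (λ i → i) G≡s
  where
  go : ∀ {A : Set} k {G′ : A → Val} (h : Fin k → A) {s} → foldr _+V_ (val 0) (map G′ (tabulate h)) ≡ val s →
    ∃ λ g → (∀ i → G′ (h i) ≡ val (g i)) × s ≡ sum g
  go zero h refl = (λ ()) , (λ ()) , refl
  go (suc k) {G′} h e with G′ (h zero) in e₀ | foldr _+V_ (val 0) (map G′ (tabulate (h ∘ suc))) in eᵣ | e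
  ... | val m | val r | refl with go k (h ∘ suc) eᵣ
  ... | g , eg , refl = (λ { zero → m ; (suc i) → g i }) , (λ { zero → e₀ ; (suc i) → eg i }) , refl

module _ (s : Tree) where

  -- yIn, y0 and y1 unfold to instances of maxDyn, with φ Y = mem Y here or its negation.
  maxDyn : (Pos s → Thr) → (List (Pos s) → Bool) → ℕ → Val
  maxDyn τ φ b = maxV (map (λ Y → val (dyn s τ (compl Y))) (filterB (λ Y → (length Y ≡ᵇ b) ∧ φ Y) (sublists (allPos s))))

  maxDyn-upper : ∀ τ φ (P : Pos s → Bool) → φ (filterB P (allPos s)) ≡ true →
    val (dyn s τ (λ x → not (P x))) ≤V maxDyn τ φ (card P)
  maxDyn-upper τ φ P φP = subst (_≤V maxDyn τ φ (card P)) (cong val (dyn-cong {τ = τ} λ x → cong not (mem-filterB-allPos P x)))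
    (maxV-upper _ (∈-map⁺ _ (∈-filterB⁺ _ _ (filterB∈sublists P (allPos s)) (cong₂ _∧_ (≡⇒≡ᵇ≡true {card P} refl) φP))))

  maxDyn-attained : ∀ τ φ b {n} → maxDyn τ φ b ≡ val n →
    ∃ λ L → L ∈ sublists (allPos s) × length L ≡ b × φ L ≡ true × dyn s τ (compl L) ≡ n
  maxDyn-attained τ φ b e with ∈-map⁻ _ (maxV-attained _ e)
  ... | L , L∈ , n≡ with ∈-filterB⁻ _ (sublists (allPos s)) L∈
  ... | L∈′ , conds = L , L∈′ , ≡ᵇ≡true⇒≡ (∧-conicalˡ _ _ conds) , ∧-conicalʳ _ _ conds , sym (val-injective n≡)

  module _ (τ : Pos s → Thr) where

    yIn-upper : (P : Pos s → Bool) → P here ≡ true → val (dyn s τ (λ x → not (P x))) ≤V yIn s τ (card P)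
    yIn-upper P P-here = maxDyn-upper τ (λ Y → mem Y here) P (trans (mem-filterB-allPos P here) P-here)

    y0-upper : (P : Pos s → Bool) → P here ≡ false → val (dyn s τ (λ x → not (P x))) ≤V y0 s τ (card P)
    y0-upper P P-here = maxDyn-upper τ (λ Y → not (mem Y here)) P (cong not (trans (mem-filterB-allPos P here) P-here))

    y1-upper : (P : Pos s → Bool) → P here ≡ false → val (dyn s (decRoot τ) (λ x → not (P x))) ≤V y1 s τ (card P)
    y1-upper P P-here = maxDyn-upper (decRoot τ) (λ Y → not (mem Y here)) P (cong not (trans (mem-filterB-allPos P here) P-here))

    yIn-attained : ∀ b {n} → yIn s τ b ≡ val n →
      ∃ λ P → P here ≡ true × card P ≡ b × dyn s τ (λ x → not (P x)) ≡ n
    yIn-attained b e with maxDyn-attained τ (λ Y → mem Y here) b e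
    ... | L , L∈ , refl , L-here , dyn≡ = mem L , L-here , card-mem L∈ , dyn≡

    y1-finite⇒small : ∀ b {n} → y1 s τ b ≡ val n → b ≤ size s ∸ 1
    y1-finite⇒small b e with maxDyn-attained (decRoot τ) (λ Y → not (mem Y here)) b e
    ... | L , L∈ , refl , root∉L , _ = small s L L∈ (not-injective root∉L)
      where
      small : ∀ s (L : List (Pos s)) → L ∈ sublists (allPos s) → mem L here ≡ false → length L ≤ size s ∸ 1
      small (node k f) L L∈ root∉L with ∈-++⁻ (sublists childPos) L∈
      ... | inj₁ L∈′ = length-mono-≤ (sublists⇒⊆ childPos L∈′)
      ... | inj₂ L∈′ with ∈-map⁻ (here ∷_) L∈′
      ... | _ , _ , refl with () ← root∉L

-- The recurrence at a vertex with children

module Recurrence {k} {f : Fin k → Tree} (τ : Pos (node k f) → Thr) where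

  τ[_] : Fin 2 → Pos (node k f) → Thr
  τ[ zero ] = τ
  τ[ suc _ ] = decRoot τ

  θ : Fin 2 → Thr
  θ j = τ here -ᵗ toℕ j

  surcharge : Fin 2 → (Fin k → Bool) → ℕ
  surcharge j C = if reached (count k C) (θ j) then 0 else 1

  surcharge-suc≤ : ∀ C → surcharge (suc zero) C ≤ surcharge zero C
  surcharge-suc≤ C with reached (count k C) (θ zero) in r₀ | reached (count k C) (θ (suc zero)) in r₁
  ... | true | true = z≤n
  ... | true | false = ⊥-elim (not-¬ (reached-minus-one _ (τ here) (trans (sym (reached-minus-zero _ (τ here))) r₀)) r₁)
  ... | false | r = zero-or-one≤1 r

  module _ (S : Pos (node k f) → Bool) where
    open RootFormula τ S using (a; a′; tight) public

  dyn-formula : ∀ j S → S here ≡ true → dyn (node k f) τ[ j ] S ≡ sum (a′ S) + surcharge j (tight S)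
  dyn-formula zero S root∈S = trans (RootFormula.dyn-root-formula τ S root∈S)
    (cong (λ r → sum (a′ S) + (if r then 0 else 1)) (sym (reached-minus-zero _ (τ here))))
  dyn-formula (suc zero) S root∈S = RootFormula.dyn-root-formula (decRoot τ) S root∈S

  G : Vec ℕ k → Vec Bool k → Fin k → Val
  G bv cv i = if lookup cv i then yIn (f i) (τ ↓ i) (lookup bv i) else y1 (f i) (τ ↓ i) (lookup bv i)

  Q : Vec ℕ k → Vec Bool k → Fin k → Bool
  Q bv cv i = not (lookup cv i) ∧ eqV (y0 (f i) (τ ↓ i) (lookup bv i)) (y1 (f i) (τ ↓ i) (lookup bv i))

  G-kept : ∀ {bv cv} i → lookup cv i ≡ false → G bv cv i ≡ y1 (f i) (τ ↓ i) (lookup bv i)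
  G-kept i c≡false rewrite c≡false = refl

  candidates : ℕ → List (Vec ℕ k × Vec Bool k)
  candidates b = filterB (λ { (bv , cv) → dominates (node k f) τ bv cv }) (cartesianProduct (compositions k b) (bits k))

  zterm-upper : ∀ j b {bv cv} → (bv , cv) ∈ candidates b → zterm (node k f) τ j bv cv ≤V z′ (node k f) τ j b
  zterm-upper j b bv,cv∈ = maxV-upper _ (∈-map⁺ _ bv,cv∈)

  candidate-sum : ∀ b {bv cv} → (bv , cv) ∈ candidates b → Vec.sum bv ≡ b
  candidate-sum b bv,cv∈ with ∈-filterB⁻ _ (cartesianProduct (compositions k b) (bits k)) bv,cv∈
  ... | ∈× , _ = ≡ᵇ≡true⇒≡ (proj₂ (∈-filterB⁻ _ (vecsUpTo k b) (proj₁ (∈-cartesianProduct⁻ (compositions k b) (bits k) ∈×))))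

  candidate⁺ : ∀ b (bv : Vec ℕ k) (cv : Vec Bool k) → Vec.sum bv ≡ b → (∀ i → lookup cv i ≡ true → 1 ≤ lookup bv i) →
    (bv , cv) ∈ candidates b
  candidate⁺ b bv cv sum≡b c≤b = ∈-filterB⁺ _ _
    (∈-cartesianProduct⁺ (∈-filterB⁺ _ (vecsUpTo k b) (vecsUpTo-complete k bv bv≤b) (≡⇒≡ᵇ≡true sum≡b)) (bits-complete cv))
    (allB⁺ _ (allFin k) λ i _ → not-∨-intro λ c → 1≤⇒1≤ᵇ (c≤b i c))
    where
    bv≤b : ∀ i → lookup bv i ≤ b
    bv≤b i = subst (lookup bv i ≤_) (trans (sym (sum-lookup bv)) sum≡b) (term≤sum (lookup bv) i)
    1≤⇒1≤ᵇ : ∀ {n} → 1 ≤ n → (1 ≤ᵇ n) ≡ true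
    1≤⇒1≤ᵇ (s≤s _) = refl
    vecsUpTo-complete : ∀ k (v : Vec ℕ k) → (∀ i → lookup v i ≤ b) → v ∈ vecsUpTo k b
    vecsUpTo-complete zero [] _ = Any.here refl
    vecsUpTo-complete (suc k) (x ∷ v) v≤b = ∈-concatMap⁺ (λ x → map (x ∷_) (vecsUpTo k b))
      (lose (∈-upTo⁺ (s≤s (v≤b zero))) (∈-map⁺ (x ∷_) (vecsUpTo-complete k v (v≤b ∘ suc))))
    bits-complete : ∀ {k} (v : Vec Bool k) → v ∈ bits k
    bits-complete [] = Any.here refl
    bits-complete {suc k} (c ∷ v) = ∈-concatMap⁺ (λ c → map (c ∷_) (bits k)) (lose (c∈ c) (∈-map⁺ (c ∷_) (bits-complete v)))
      where
      c∈ : ∀ c → c ∈ (false ∷ true ∷ [])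
      c∈ false = Any.here refl
      c∈ true = Any.there (Any.here refl)

  yj-upper : ∀ j (P : Pos (node k f) → Bool) → P here ≡ false →
    val (dyn (node k f) τ[ j ] (λ x → not (P x))) ≤V yj j (node k f) τ (card P)
  yj-upper zero = y0-upper (node k f) τ
  yj-upper (suc zero) = y1-upper (node k f) τ

  module Removal (P : Pos (node k f) → Bool) (root∉P : P here ≡ false) where

    S : Pos (node k f) → Bool
    S x = not (P x)

    bv : Vec ℕ k
    bv = Vec.tabulate (λ i → card (P ↓ i))

    cv : Vec Bool k
    cv = Vec.tabulate (λ i → P (there i here))

    lookup-bv : ∀ i → lookup bv i ≡ card (P ↓ i)
    lookup-bv = Vec.lookup∘tabulate (λ i → card (P ↓ i))

    lookup-cv : ∀ i → lookup cv i ≡ P (there i here)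
    lookup-cv = Vec.lookup∘tabulate (λ i → P (there i here))

    bv,cv∈ : (bv , cv) ∈ candidates (card P)
    bv,cv∈ = candidate⁺ (card P) bv cv sum-bv c≤b
      where
      sum-bv : Vec.sum bv ≡ card P
      sum-bv = begin
        Vec.sum bv                  ≡⟨ sum-lookup bv ⟩
        sum (lookup bv)             ≡⟨ sum-cong-≗ lookup-bv ⟩
        sum (λ i → card (P ↓ i))    ≡⟨ cong (_+ sum (λ i → card (P ↓ i))) (cong bit (sym root∉P)) ⟩
        bit (P here) + sum (λ i → card (P ↓ i)) ≡⟨ sym (card-node P) ⟩
        card P                      ∎
        where open ≡-Reasoning
      c≤b : ∀ i → lookup cv i ≡ true → 1 ≤ lookup bv i
      c≤b i c rewrite lookup-cv i | lookup-bv i =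
        subst (λ r → bit r ≤ card (P ↓ i)) c (bit-here≤card (P ↓ i))

    a′≤G : ∀ i → val (a′ S i) ≤V G bv cv i
    a′≤G i rewrite lookup-cv i | lookup-bv i
      with P (there i here) in child∈P
    ... | true = subst (_≤V yIn (f i) (τ ↓ i) (card (P ↓ i)))
                   (cong val (sym (dyn-decRoot-absent (f i) (τ ↓ i) (S ↓ i) (cong not child∈P))))
                   (yIn-upper (f i) (τ ↓ i) (P ↓ i) child∈P)
    ... | false = y1-upper (f i) (τ ↓ i) (P ↓ i) child∈P

    g : Fin k → ℕ
    g i = proj₁ (val≤V⁻ (a′≤G i))

    G≡g : ∀ i → G bv cv i ≡ val (g i)
    G≡g i = proj₁ (proj₂ (val≤V⁻ (a′≤G i)))

    a′≤g : ∀ i → a′ S i ≤ g i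
    a′≤g i = proj₂ (proj₂ (val≤V⁻ (a′≤G i)))

    -- A child counted by Q but not tight has y_0 = y_1 ≥ a > a′.
    slack : ∀ j → reached (count k (Q bv cv)) (θ j) ≡ true → reached (count k (tight S)) (θ j) ≡ false →
      ∃ λ i → a′ S i < g i
    slack j enough not-enough with ⊆-or-witness (Q bv cv) (tight S)
    ... | inj₁ Q⊆tight = ⊥-elim (not-¬ (reached-mono (θ j) (count-mono k Q⊆tight) enough) not-enough)
    ... | inj₂ (i , Qi , not-tight) = i , <-≤-trans (≤∧≢⇒< (dyn-decRoot-≤ (f i) (τ ↓ i) (S ↓ i)) a′≢a) a≤g
      where
      child∉P : P (there i here) ≡ false
      child∉P = trans (sym (lookup-cv i)) (not-injective (∧-conicalˡ _ _ Qi))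
      y1≡g : y1 (f i) (τ ↓ i) (lookup bv i) ≡ val (g i)
      y1≡g = trans (sym (G-kept {bv} {cv} i (trans (lookup-cv i) child∉P))) (G≡g i)
      y0≡g : y0 (f i) (τ ↓ i) (lookup bv i) ≡ val (g i)
      y0≡g = eqV-val (subst (λ w → eqV (y0 (f i) (τ ↓ i) (lookup bv i)) w ≡ true) y1≡g (∧-conicalʳ _ _ Qi))
        where
        eqV-val : ∀ {u n} → eqV u (val n) ≡ true → u ≡ val n
        eqV-val {val m} e = cong val (≡ᵇ≡true⇒≡ e)
      a≤g : a S i ≤ g i
      a≤g with subst (val (a S i) ≤V_) (trans (cong (y0 (f i) (τ ↓ i)) (sym (lookup-bv i))) y0≡g)
                       (y0-upper (f i) (τ ↓ i) (P ↓ i) child∉P)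
      ... | val≤ le = le
      a′≢a : a′ S i ≢ a S i
      a′≢a a′≡a = not-¬ (cong₂ _∧_ (cong not child∉P) (≡⇒≡ᵇ≡true (sym a′≡a))) not-tight

    removal≤zterm : ∀ j → val (dyn (node k f) τ[ j ] S) ≤V zterm (node k f) τ j bv cv
    removal≤zterm j = subst₂ _≤V_ (cong val (sym (dyn-formula j S (cong not root∉P))))
      (cong (val (surcharge j (Q bv cv)) +V_) (sym (sumV-val (G bv cv) g G≡g)))
      (val≤ (sum-plus-surcharge-≤ _ _ a′≤g (slack j)))

  yj≡maxDyn : ∀ j b → yj j (node k f) τ b ≡ maxDyn (node k f) τ[ j ] (λ Y → not (mem Y here)) b
  yj≡maxDyn zero b = refl
  yj≡maxDyn (suc zero) b = refl

  yj≤z′ : ∀ j b → yj j (node k f) τ b ≤V z′ (node k f) τ j b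
  yj≤z′ j b rewrite yj≡maxDyn j b = maxV-least _ λ v v∈ → case (∈-map⁻ _ v∈)
    where
    case : ∀ {v} → ∃ (λ Y → Y ∈ filterB (λ Y → (length Y ≡ᵇ b) ∧ not (mem Y here)) (sublists (allPos (node k f)))
                               × v ≡ val (dyn (node k f) τ[ j ] (compl Y))) → v ≤V z′ (node k f) τ j b
    case (Y , Y∈ , refl) with ∈-filterB⁻ _ (sublists (allPos (node k f))) Y∈
    ... | Y∈′ , conds = ≤V-trans (removal≤zterm j) (subst (λ b′ → zterm (node k f) τ j bv cv ≤V z′ (node k f) τ j b′) card≡b
                                                         (zterm-upper j _ bv,cv∈))
      where
      open Removal (mem Y) (not-injective (∧-conicalʳ _ _ conds))
      card≡b : card (mem Y) ≡ b
      card≡b = trans (card-mem Y∈′) (≡ᵇ≡true⇒≡ (∧-conicalˡ _ _ conds))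

  ChildHypothesis : Set
  ChildHypothesis = ∀ (i : Fin k) (bᵢ : ℕ) → bᵢ ≤ size (f i) ∸ 1 →
    Σ (Pos (f i) → Bool) λ Y →
      (Y here ≡ false) × (card Y ≡ bᵢ) ×
      (val (dyn (f i) (τ ↓ i) (λ x → not (Y x))) ≡ y0 (f i) (τ ↓ i) bᵢ) ×
      (val (dyn (f i) (decRoot (τ ↓ i)) (λ x → not (Y x))) ≡ y1 (f i) (τ ↓ i) bᵢ)

  record ChildChoice (i : Fin k) (c : Bool) (bᵢ gᵢ : ℕ) : Set where
    field
      removed : Pos (f i) → Bool
      root-removed : removed here ≡ c
      card-removed : card removed ≡ bᵢ
      dyn′-kept : dyn (f i) (decRoot (τ ↓ i)) (λ x → not (removed x)) ≡ gᵢ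
      tight-kept : c ≡ false →
        (dyn (f i) (τ ↓ i) (λ x → not (removed x)) ≡ᵇ dyn (f i) (decRoot (τ ↓ i)) (λ x → not (removed x)))
          ≡ eqV (y0 (f i) (τ ↓ i) bᵢ) (y1 (f i) (τ ↓ i) bᵢ)

  choose : ChildHypothesis → ∀ i c bᵢ {gᵢ} →
    (if c then yIn (f i) (τ ↓ i) bᵢ else y1 (f i) (τ ↓ i) bᵢ) ≡ val gᵢ → ChildChoice i c bᵢ gᵢ
  choose hyp i true bᵢ yIn≡g with yIn-attained (f i) (τ ↓ i) bᵢ yIn≡g
  ... | P , P-here , card-P , dyn≡ = record
    { removed = P ; root-removed = P-here ; card-removed = card-P
    ; dyn′-kept = trans (dyn-decRoot-absent (f i) (τ ↓ i) _ (cong not P-here)) dyn≡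
    ; tight-kept = λ () }
  choose hyp i false bᵢ y1≡g with hyp i bᵢ (y1-finite⇒small (f i) (τ ↓ i) bᵢ y1≡g)
  ... | Y , Y-here , card-Y , y0≡ , y1≡ = record
    { removed = Y ; root-removed = Y-here ; card-removed = card-Y
    ; dyn′-kept = val-injective (trans y1≡ y1≡g)
    ; tight-kept = λ _ → cong₂ eqV y0≡ y1≡ }

  module Realisation (hyp : ChildHypothesis) {b} {bv : Vec ℕ k} {cv : Vec Bool k} (bv,cv∈ : (bv , cv) ∈ candidates b)
                     {s} (G≡s : sumV (G bv cv) ≡ val s) where

    g : Fin k → ℕ
    g = proj₁ (sumV-val⁻ (G bv cv) G≡s)

    G≡sum-g : sumV (G bv cv) ≡ val (sum g)
    G≡sum-g = trans G≡s (cong val (proj₂ (proj₂ (sumV-val⁻ (G bv cv) G≡s))))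

    chosen : ∀ i → ChildChoice i (lookup cv i) (lookup bv i) (g i)
    chosen i = choose hyp i (lookup cv i) (lookup bv i) (proj₁ (proj₂ (sumV-val⁻ (G bv cv) G≡s)) i)

    open module Chosen i = ChildChoice (chosen i)

    Y : Pos (node k f) → Bool
    Y = glue false removed

    S : Pos (node k f) → Bool
    S x = not (Y x)

    card-Y : card Y ≡ b
    card-Y = trans (card-node Y) (trans (sum-cong-≗ card-removed) (trans (sym (sum-lookup bv)) (candidate-sum b bv,cv∈)))

    tight≡Q : ∀ i → tight S i ≡ Q bv cv i
    tight≡Q i = not∧-cong (root-removed i) (tight-kept i)
      where
      not∧-cong : ∀ {p c X Y} → p ≡ c → (c ≡ false → X ≡ Y) → not p ∧ X ≡ not c ∧ Y
      not∧-cong {c = true} refl _ = refl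
      not∧-cong {c = false} refl X≡Y = X≡Y refl

    dyn≡zterm : ∀ j → val (dyn (node k f) τ[ j ] S) ≡ zterm (node k f) τ j bv cv
    dyn≡zterm j = begin
      val (dyn (node k f) τ[ j ] S)                         ≡⟨ cong val (dyn-formula j S refl) ⟩
      val (sum (a′ S) + surcharge j (tight S))               ≡⟨ cong val (cong₂ _+_ (sum-cong-≗ dyn′-kept)
                                                                  (cong (λ n → if reached n (θ j) then 0 else 1) (count-cong k tight≡Q))) ⟩
      val (sum g + surcharge j (Q bv cv))                    ≡⟨ cong val (+-comm (sum g) _) ⟩
      val (surcharge j (Q bv cv)) +V val (sum g)             ≡⟨ cong (val (surcharge j (Q bv cv)) +V_) (sym G≡sum-g) ⟩
      zterm (node k f) τ j bv cv                             ∎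
      where open ≡-Reasoning

  z′≤yj : ChildHypothesis → ∀ j b → z′ (node k f) τ j b ≤V yj j (node k f) τ b
  z′≤yj hyp j b = maxV-least _ λ v v∈ → case (∈-map⁻ _ v∈)
    where
    realised : ∀ {bv cv} → (bv , cv) ∈ candidates b → ∀ sv → sumV (G bv cv) ≡ sv →
      val (surcharge j (Q bv cv)) +V sv ≤V yj j (node k f) τ b
    realised _ -∞ _ = -∞≤
    realised {bv} {cv} bv,cv∈ (val s) G≡s =
      subst₂ _≤V_ (trans (dyn≡zterm j) (cong (val (surcharge j (Q bv cv)) +V_) G≡s)) (cong (yj j (node k f) τ) card-Y)
             (yj-upper j Y refl)
      where open Realisation hyp bv,cv∈ G≡s
    case : ∀ {v} → ∃ (λ p → p ∈ candidates b × v ≡ zterm (node k f) τ j (proj₁ p) (proj₂ p)) → v ≤V yj j (node k f) τ b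
    case ((bv , cv) , bv,cv∈ , refl) = realised bv,cv∈ (sumV (G bv cv)) refl

  yj-finite : ∀ j b → b ≤ size (node k f) ∸ 1 → ∃ λ n → yj j (node k f) τ b ≡ val n
  yj-finite j b b≤ with sublist-of-length childPos b b≤
  ... | L , L∈ , L≡b with val≤V⁻ (yj-upper j (mem L) root∉L)
    where
    root∉L : mem L here ≡ false
    root∉L with mem L here in root∈L
    ... | false = refl
    ... | true = ⊥-elim (here∉childPos (Any-resp-⊆ (sublists⇒⊆ childPos L∈) (mem⇒∈ L here root∈L)))
  ... | n , yj≡n , _ = n , trans (cong (yj j (node k f) τ) (trans (sym L≡b) (sym (card-mem (∈-++⁺ˡ L∈))))) yj≡n

  Simultaneous : ℕ → Set
  Simultaneous b = Σ (Pos (node k f) → Bool) λ Y →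
    (Y here ≡ false) × (card Y ≡ b) ×
    (val (dyn (node k f) τ (λ x → not (Y x))) ≡ y0 (node k f) τ b) ×
    (val (dyn (node k f) (decRoot τ) (λ x → not (Y x))) ≡ y1 (node k f) τ b)

  module _ (hyp : ChildHypothesis) (b : ℕ) where

    private
      y≡z′ : ∀ j → yj j (node k f) τ b ≡ z′ (node k f) τ j b
      y≡z′ j = ≤V-antisym (yj≤z′ j b) (z′≤yj hyp j b)

      optimum : ∀ j {m} → yj j (node k f) τ b ≡ val m → ∃ λ p → p ∈ candidates b × ∃ λ s →
        sumV (G (proj₁ p) (proj₂ p)) ≡ val s × m ≡ surcharge j (Q (proj₁ p) (proj₂ p)) + s
      optimum j {m} y≡m with ∈-map⁻ {A = Vec ℕ k × Vec Bool k} (λ { (bv , cv) → zterm (node k f) τ j bv cv })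
                                    (maxV-attained _ (trans (sym (y≡z′ j)) y≡m))
      ... | (bv , cv) , p∈ , m≡ = (bv , cv) , p∈ , split (sumV (G bv cv)) refl
        where
        split : ∀ sv → sumV (G bv cv) ≡ sv → ∃ λ s → sumV (G bv cv) ≡ val s × m ≡ surcharge j (Q bv cv) + s
        split (val s) G≡s = s , G≡s , val-injective (trans m≡ (cong (val (surcharge j (Q bv cv)) +V_) G≡s))
        split -∞ G≡-∞ with () ← trans m≡ (cong (val (surcharge j (Q bv cv)) +V_) G≡-∞)

      bounded : ∀ j {bv cv s m} → (bv , cv) ∈ candidates b → sumV (G bv cv) ≡ val s → yj j (node k f) τ b ≡ val m →
        surcharge j (Q bv cv) + s ≤ m
      bounded j {bv} {cv} p∈ G≡s y≡m
        with subst₂ _≤V_ (cong (val (surcharge j (Q bv cv)) +V_) G≡s) (trans (sym (y≡z′ j)) y≡m) (zterm-upper j b p∈)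
      ... | val≤ le = le

      realise : ∀ {bv cv s m₀ m₁} → (bv , cv) ∈ candidates b → sumV (G bv cv) ≡ val s →
        surcharge zero (Q bv cv) + s ≡ m₀ → surcharge (suc zero) (Q bv cv) + s ≡ m₁ →
        y0 (node k f) τ b ≡ val m₀ → y1 (node k f) τ b ≡ val m₁ → Simultaneous b
      realise {bv} {cv} p∈ G≡s v₀≡ v₁≡ y₀≡ y₁≡ = Y , refl , card-Y , value zero v₀≡ y₀≡ , value (suc zero) v₁≡ y₁≡
        where
        open Realisation hyp p∈ G≡s
        value : ∀ j {m} → surcharge j (Q bv cv) + _ ≡ m → yj j (node k f) τ b ≡ val m →
          val (dyn (node k f) τ[ j ] (λ x → not (Y x))) ≡ yj j (node k f) τ b
        value j v≡ y≡ = trans (dyn≡zterm j)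
          (trans (cong (val (surcharge j (Q bv cv)) +V_) G≡s) (trans (cong val v≡) (sym y≡)))

    simultaneous : b ≤ size (node k f) ∸ 1 → Simultaneous b
    simultaneous b≤ with yj-finite zero b b≤ | yj-finite (suc zero) b b≤
    ... | m₀ , y₀≡m₀ | m₁ , y₁≡m₁ with optimum zero y₀≡m₀ | optimum (suc zero) y₁≡m₁
    ... | (bv₀ , cv₀) , p₀∈ , s₀ , G₀≡s₀ , m₀≡ | (bv₁ , cv₁) , p₁∈ , s₁ , G₁≡s₁ , m₁≡
      with one-of-two-maxima (sym m₀≡) (sym m₁≡) (bounded (suc zero) p₀∈ G₀≡s₀ y₁≡m₁) (bounded zero p₁∈ G₁≡s₁ y₀≡m₀)
             (+-monoˡ-≤ s₀ (≤-trans (zero-or-one≤1 _) (s≤s z≤n))) (+-monoˡ-≤ s₁ (surcharge-suc≤ (Q bv₁ cv₁)))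
    ... | inj₁ x₁≡m₁ = realise p₀∈ G₀≡s₀ (sym m₀≡) x₁≡m₁ y₀≡m₀ y₁≡m₁
    ... | inj₂ y₀≡m₀′ = realise p₁∈ G₁≡s₁ y₀≡m₀′ (sym m₁≡) y₀≡m₀ y₁≡m₁

recurrence : (t : Tree) (τ : Pos t → Thr) →
  (∀ (i : Fin (deg t)) (bᵢ : ℕ) → bᵢ ≤ size (child t i) ∸ 1 →
    Σ (Pos (child t i) → Bool) λ Y →
      (Y here ≡ false) × (card Y ≡ bᵢ) ×
      (val (dyn (child t i) (τchild t τ i) (λ x → not (Y x))) ≡ y0 (child t i) (τchild t τ i) bᵢ) ×
      (val (dyn (child t i) (decRoot (τchild t τ i)) (λ x → not (Y x))) ≡ y1 (child t i) (τchild t τ i) bᵢ)) →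
  (b : ℕ) →
  (∀ (j : Fin 2) → yj j t τ b ≡ z′ t τ j b) ×
  (b ≤ size t ∸ 1 →
    Σ (Pos t → Bool) λ Y →
      (Y here ≡ false) × (card Y ≡ b) ×
      (val (dyn t τ (λ x → not (Y x))) ≡ y0 t τ b) ×
      (val (dyn t (decRoot τ) (λ x → not (Y x))) ≡ y1 t τ b))
recurrence (node k f) τ hyp b = (λ j → ≤V-antisym (yj≤z′ j b) (z′≤yj hyp j b)) , simultaneous hyp b
  where open Recurrence τ

lemma10 : (T : Tree) (τ : Pos T → Thr) (u : Pos T) →
    0 < deg (sub T u) →
    (∀ (i : Fin (deg (sub T u))) (bᵢ : ℕ) → bᵢ ≤ size (child (sub T u) i) ∸ 1 →
      Σ (Pos (child (sub T u) i) → Bool) λ Y →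
        (Y here ≡ false) × (card Y ≡ bᵢ) ×
        (val (dyn (child (sub T u) i) (τchild (sub T u) (λ p → τ (emb T u p)) i) (λ x → not (Y x)))
          ≡ y0 (child (sub T u) i) (τchild (sub T u) (λ p → τ (emb T u p)) i) bᵢ) ×
        (val (dyn (child (sub T u) i) (decRoot (τchild (sub T u) (λ p → τ (emb T u p)) i)) (λ x → not (Y x)))
          ≡ y1 (child (sub T u) i) (τchild (sub T u) (λ p → τ (emb T u p)) i) bᵢ)) →
    (b : ℕ) →
    (∀ (j : Fin 2) → yj j (sub T u) (λ p → τ (emb T u p)) b ≡ z′ (sub T u) (λ p → τ (emb T u p)) j b) ×
    (b ≤ size (sub T u) ∸ 1 →
      Σ (Pos (sub T u) → Bool) λ Y →
        (Y here ≡ false) × (card Y ≡ b) ×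
        (val (dyn (sub T u) (λ p → τ (emb T u p)) (λ x → not (Y x))) ≡ y0 (sub T u) (λ p → τ (emb T u p)) b) ×
        (val (dyn (sub T u) (decRoot (λ p → τ (emb T u p))) (λ x → not (Y x))) ≡ y1 (sub T u) (λ p → τ (emb T u p)) b))
-- The recurrence holds at leaves as well, so u need not have children.
lemma10 T τ u _ = recurrence (sub T u) (λ p → τ (emb T u p))
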